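{- Let $n\ge1$, $R\le D_8$, and $T$ a set of tile designs for $R$. For $g\in R$ let $\mathrm{Fix}^{\mathrm{sq}}_g(n)=\sum_{(a,b)\in(\mathbb{Z}/n\mathbb{Z})^2}|X^{((a,b),g)}|$, where $X^{((a,b),g)}$ is the set of tilings of the $n\times n$ torus fixed by $((a,b),g)$. If $rf\in R$ then $$\mathrm{Fix}^{\mathrm{sq}}_{rf}(n)=n\sum_{d\mid n}\begin{cases}\varphi(d)\,t_{\mathrm{id}}^{(n^2-n)/(2d)}t_{rf}^{n/d} & d\text{ odd},\\ \varphi(d)\,t_{\mathrm{id}}^{n^2/(2d)} & d\text{ even},\end{cases}$$ and if $r^3f\in R$ then $$\mathrm{Fix}^{\mathrm{sq}}_{r^3f}(n)=n\sum_{d\mid n}\begin{cases}\varphi(d)\,t_{\mathrm{id}}^{(n^2-n)/(2d)}t_{r^3f}^{n/d} & d\text{ odd},\\ \varphi(d)\,t_{\mathrm{id}}^{n^2/(2d)} & d\text{ even},\end{cases}$$ where $\varphi$ is Euler's totient function.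
   Context: Cells: $\mathbb{Z}/n\mathbb{Z}\times\mathbb{Z}/n\mathbb{Z}$. $D_8=\langle r,f\mid r^4=f^2=(rf)^2=\mathrm{id}\rangle$ acts on cells on the right, determined by $(x,y)\cdot f=(n-1-x,y)$ and $(x,y)\cdot r=(n-1-y,x)$; thus $(x,y)\cdot rf=(y,x)$ and $(x,y)\cdot r^3f=(n-1-y,n-1-x)$. For $(a,b)\in(\mathbb{Z}/n\mathbb{Z})^2$ and $g\in R$, $(x,y)\cdot((a,b),g)=(x+a,y+b)\cdot g$. A set of tile designs for $R$ is a finite set $T$ with a right $R$-action; $t_g=|\{d\in T:d\cdot g=d\}|$. A tiling is a map $\tau$ from cells to $T$; $\tau$ is fixed by $s=((a,b),g)$ if $\tau(c\cdot s)=\tau(c)\cdot g$ for all cells $c$. -}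

module Defs where

open import Data.Bool using (Bool; true; false; T; if_then_else_)
open import Data.Nat using (ℕ; zero; suc; _+_; _*_; _∸_; _%_; _/_; _≡ᵇ_; NonZero)
open import Data.Nat.DivMod using (m%n<n)
open import Data.Nat.GCD using (gcd)
open import Data.Nat.Divisibility using (_∣?_)
open import Data.Fin using (Fin; toℕ; fromℕ<; opposite)
open import Data.Fin.Patterns using (0F; 1F; 3F)
open import Relation.Nullary.Decidable using (map′)
open import Data.Fin.Properties using (all?; _≟_)
open import Data.Product using (_×_; _,_; Σ)
open import Data.List using (List; []; _∷_; map; filter; length; upTo; allFin; concatMap)
open import Data.Nat.ListAction using (sum)
open import Data.Vec using (Vec; lookup) renaming ([] to []ᵛ; _∷_ to _∷ᵛ_)
open import Relation.Binary.PropositionalEquality using (_≡_)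
open import Relation.Nullary using (Dec; does)
open import Function using (_∘_)

totient : ℕ → ℕ
totient d = length (filter (λ k → Data.Nat._≟_ (gcd k d) 1) (map suc (upTo d)))

-- Natural-number division, with the (never used) convention m div 0 = 0.
_div_ : ℕ → ℕ → ℕ
m div zero = 0
m div suc k = m / suc k

isOdd : ℕ → Bool
isOdd d = d % 2 ≡ᵇ 1

divisorSum : ℕ → (ℕ → ℕ) → ℕ
divisorSum n F = sum (map F (filter (_∣? n) (map suc (upTo n))))

_+₄_ : Fin 4 → Fin 4 → Fin 4
a +₄ b = fromℕ< (m%n<n (toℕ a + toℕ b) 4)

_-₄_ : Fin 4 → Fin 4 → Fin 4
a -₄ b = fromℕ< (m%n<n (toℕ a + (4 ∸ toℕ b)) 4)

-- The dihedral group D8 = ⟨ r , f ∣ r^4 = f^2 = (rf)^2 = id ⟩.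
-- ρ k  denotes  r^k ,  σ k  denotes  r^k f.

data D8 : Set where
  ρ : Fin 4 → D8
  σ : Fin 4 → D8

-- group product (using f r^c = r^{-c} f)
_∙_ : D8 → D8 → D8
ρ a ∙ ρ c = ρ (a +₄ c)
ρ a ∙ σ c = σ (a +₄ c)
σ a ∙ ρ c = σ (a -₄ c)
σ a ∙ σ c = ρ (a -₄ c)

idD8 r f rf r3f : D8
idD8 = ρ 0F
r    = ρ 1F
f    = σ 0F
rf   = σ 1F
r3f  = σ 3F

-- Subgroups R ≤ D8 (given by a membership predicate; in a finite group
-- closure under identity and product is equivalent to being a subgroup,
-- but we also ask for closure under inverses to match the definition).
inv : D8 → D8
inv (ρ a) = ρ (0F -₄ a)
inv (σ a) = σ a

record Subgroup : Set where
  field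
    mem     : D8 → Bool
    id∈     : T (mem idD8)
    ∙-closed : ∀ g h → T (mem g) → T (mem h) → T (mem (g ∙ h))
    inv-closed : ∀ g → T (mem g) → T (mem (inv g))

_∈_ : D8 → Subgroup → Set
g ∈ R = T (Subgroup.mem R g)

record TileSet (R : Subgroup) : Set where
  field
    size   : ℕ
    act    : Fin size → (g : D8) → g ∈ R → Fin size
    act-id : ∀ d (p : idD8 ∈ R) → act d idD8 p ≡ d
    act-∙  : ∀ d g h (p : g ∈ R) (q : h ∈ R) (pq : (g ∙ h) ∈ R) →
             act (act d g p) h q ≡ act d (g ∙ h) pq

tfix : {R : Subgroup} (Ts : TileSet R) (g : D8) → g ∈ R → ℕ
tfix Ts g p = length (filter (λ d → act d g p ≟ d) (allFin size))
  where open TileSet Ts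

Cell : ℕ → Set
Cell n = Fin n × Fin n

rotCell : ∀ {n} → Cell n → Cell n
rotCell (x , y) = (opposite y , x)

flipCell : ∀ {n} → Cell n → Cell n
flipCell (x , y) = (opposite x , y)

iterate : ∀ {A : Set} → ℕ → (A → A) → A → A
iterate zero    h a = a
iterate (suc k) h a = iterate k h (h a)

cellAct : ∀ {n} → Cell n → D8 → Cell n
cellAct c (ρ k) = iterate (toℕ k) rotCell c
cellAct c (σ k) = flipCell (iterate (toℕ k) rotCell c)

_+ₙ_ : ∀ {n} .{{_ : NonZero n}} → Fin n → Fin n → Fin n
_+ₙ_ {n} a b = fromℕ< (m%n<n (toℕ a + toℕ b) n)

affAct : ∀ {n} .{{_ : NonZero n}} → Cell n → Cell n → D8 → Cell n
affAct (x , y) (a , b) g = cellAct (x +ₙ a , y +ₙ b) g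

Tiling : ℕ → ℕ → Set
Tiling n m = Vec (Vec (Fin m) n) n

tileAt : ∀ {n m} → Tiling n m → Cell n → Fin m
tileAt τ (x , y) = lookup (lookup τ x) y

allVecs : ∀ {A : Set} → List A → (k : ℕ) → List (Vec A k)
allVecs xs zero    = []ᵛ ∷ []
allVecs xs (suc k) = concatMap (λ x → map (x ∷ᵛ_) (allVecs xs k)) xs

allTilings : (n m : ℕ) → List (Tiling n m)
allTilings n m = allVecs (allVecs (allFin m) n) n

IsFixed : ∀ {n} .{{_ : NonZero n}} {R : Subgroup} (Ts : TileSet R) →
          Tiling n (TileSet.size Ts) → Cell n → (g : D8) → g ∈ R → Set
IsFixed Ts τ ab g p = ∀ c → tileAt τ (affAct c ab g) ≡ TileSet.act Ts (tileAt τ c) g p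

isFixed? : ∀ {n} .{{_ : NonZero n}} {R : Subgroup} (Ts : TileSet R) →
           (τ : Tiling n (TileSet.size Ts)) (ab : Cell n) (g : D8) (p : g ∈ R) →
           Dec (IsFixed Ts τ ab g p)
isFixed? Ts τ ab g p =
  map′ (λ h c → h (Data.Product.proj₁ c) (Data.Product.proj₂ c)) (λ h x y → h (x , y))
    (all? (λ x → all? (λ y → tileAt τ (affAct (x , y) ab g) ≟ TileSet.act Ts (tileAt τ (x , y)) g p)))

numFixed : ∀ {n} .{{_ : NonZero n}} {R : Subgroup} (Ts : TileSet R) →
           Cell n → (g : D8) → g ∈ R → ℕ
numFixed {n} Ts ab g p = length (filter (λ τ → isFixed? Ts τ ab g p) (allTilings n (TileSet.size Ts)))

FixSq : (n : ℕ) .{{_ : NonZero n}} {R : Subgroup} (Ts : TileSet R) → (g : D8) → g ∈ R → ℕ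
FixSq n Ts g p = sum (map (λ a → sum (map (λ b → numFixed Ts (a , b) g p) (allFin n))) (allFin n))

{-# OPTIONS --safe #-}
module Submission where

-- For g = rf the cell map of s = ((a , b) , rf) is φ (x , y) = (y + b , x + a), and φ² is the
-- translation by (k , k), k = a + b.  With e the additive order of k in ℤ/n, every φ-orbit has
-- length 2e, except that for odd e the n cells fixed by φ^e (a graph over the y-axis) form orbits
-- of length e.  A tiling fixed by s is determined by its values on orbit representatives, the value
-- t on an orbit of length L being subject only to t · rf^L = t.  Since rf is an involution, a long
-- orbit admits all t_id tiles and a short one the t_rf tiles fixed by rf, so |X^s| is
-- t_id^((n²-n)/2e) t_rf^(n/e) for odd e and t_id^(n²/2e) for even e.  Summing over b, a + b runs
-- once through ℤ/n, and for each d ∣ n exactly totient d residues have order d.  Reflecting the second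
-- coordinate conjugates ((a , b) , r³f) to ((a , -b) , rf), which gives the second formula.

open import Data.Bool using (Bool; true; false; not; T; _∧_; if_then_else_)
open import Data.Bool.Properties using (∧-identityʳ; ∧-zeroʳ)
open import Data.Empty using (⊥-elim)
open import Data.Fin using (Fin; zero; suc; toℕ; fromℕ<; opposite; combine; remQuot)
import Data.Fin.Properties as Finₚ
open import Data.Fin.Properties using () renaming (_≟_ to _≟ᶠ_)
open import Data.List using (List; []; _∷_; _++_; map; filter; length; concatMap; tabulate; allFin; upTo; applyUpTo)
import Data.List.Properties as Listₚ
open import Data.Nat using (ℕ; zero; suc; _+_; _*_; _∸_; _^_; _<_; _≤_; _<ᵇ_; _≡ᵇ_; z≤n; s≤s; NonZero; _/_; _%_)
  renaming (_≟_ to _≟ℕ_)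
open import Data.Nat.Properties
open import Algebra.Properties.CommutativeSemigroup +-commutativeSemigroup
  using () renaming (interchange to +-interchange)
open import Algebra.Properties.CommutativeSemigroup *-commutativeSemigroup
  using () renaming (interchange to *-interchange; x∙yz≈y∙xz to x*[y*z]≡y*[x*z])
open import Data.Nat.Base using (≢-nonZero; ≢-nonZero⁻¹; >-nonZero; >-nonZero⁻¹)
open import Data.Nat.Coprimality as Coprimality using (coprime-/gcd; coprime-divisor)
open import Data.Nat.DivMod hiding (_div_)
open import Data.Nat.Divisibility
open import Data.Nat.GCD
open import Data.Nat.ListAction using (sum)
open import Data.Nat.Solver using (module +-*-Solver)
open +-*-Solver using (solve; _:=_; _:+_; _:*_; con)
open import Data.Product using (_×_; _,_; proj₁; proj₂; ∃)
open import Data.Sum using (inj₁; inj₂)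
open import Data.Vec using (Vec; lookup) renaming ([] to []ᵛ; _∷_ to _∷ᵛ_)
import Data.Vec as Vec
import Data.Vec.Properties as Vecₚ
open import Function using (_∘_; mk⇔)
open import Level using (0ℓ)
open import Relation.Binary.Definitions using (DecidableEquality; tri<; tri≈; tri>)
open import Relation.Binary.PropositionalEquality
  using (_≡_; _≢_; refl; sym; trans; cong; cong₂; subst; subst₂; module ≡-Reasoning)
open import Relation.Nullary using (Dec; yes; no; does; _×-dec_)
open import Relation.Nullary.Decidable using (dec-true; dec-false; does-⇔; map′)
open import Relation.Unary using (Pred; Decidable)

open import Defs

private variable X Y : Set

ind : Bool → ℕ
ind true  = 1
ind false = 0

sumL : List X → (X → ℕ) → ℕ
sumL []       w = 0
sumL (x ∷ xs) w = w x + sumL xs w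

count : (X → Bool) → List X → ℕ
count P xs = sumL xs (λ x → ind (P x))

sum∘map≡sumL : (w : X → ℕ) (xs : List X) → sum (map w xs) ≡ sumL xs w
sum∘map≡sumL w []       = refl
sum∘map≡sumL w (x ∷ xs) = cong (w x +_) (sum∘map≡sumL w xs)

length∘filter≡count : {P : Pred X 0ℓ} (P? : Decidable P) (xs : List X) →
                      length (filter P? xs) ≡ count (λ x → does (P? x)) xs
length∘filter≡count P? []       = refl
length∘filter≡count P? (x ∷ xs) with does (P? x)
... | true  = cong suc (length∘filter≡count P? xs)
... | false = length∘filter≡count P? xs

sumL-filter : {P : Pred X 0ℓ} (P? : Decidable P) (xs : List X) (w : X → ℕ) →
              sumL (filter P? xs) w ≡ sumL xs (λ x → ind (does (P? x)) * w x)
sumL-filter P? []       w = refl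
sumL-filter P? (x ∷ xs) w with does (P? x)
... | true  = cong₂ _+_ (sym (+-identityʳ (w x))) (sumL-filter P? xs w)
... | false = sumL-filter P? xs w

sumL-cong : (xs : List X) {v w : X → ℕ} → (∀ x → v x ≡ w x) → sumL xs v ≡ sumL xs w
sumL-cong []       e = refl
sumL-cong (x ∷ xs) e = cong₂ _+_ (e x) (sumL-cong xs e)

sumL-zero : (xs : List X) → sumL xs (λ _ → 0) ≡ 0
sumL-zero []       = refl
sumL-zero (x ∷ xs) = sumL-zero xs

sumL-+ : (xs : List X) (v w : X → ℕ) → sumL xs (λ x → v x + w x) ≡ sumL xs v + sumL xs w
sumL-+ []       v w = refl
sumL-+ (x ∷ xs) v w = trans (cong (v x + w x +_) (sumL-+ xs v w)) (+-interchange (v x) (w x) _ _)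

sumL-*ˡ : (xs : List X) (c : ℕ) (w : X → ℕ) → sumL xs (λ x → c * w x) ≡ c * sumL xs w
sumL-*ˡ []       c w = sym (*-zeroʳ c)
sumL-*ˡ (x ∷ xs) c w = trans (cong (c * w x +_) (sumL-*ˡ xs c w)) (sym (*-distribˡ-+ c (w x) _))

sumL-*ʳ : (xs : List X) (c : ℕ) (w : X → ℕ) → sumL xs (λ x → w x * c) ≡ sumL xs w * c
sumL-*ʳ xs c w = trans (sumL-cong xs (λ x → *-comm (w x) c)) (trans (sumL-*ˡ xs c w) (*-comm c _))

sumL-comm : (xs : List X) (ys : List Y) (w : X → Y → ℕ) →
            sumL xs (λ x → sumL ys (w x)) ≡ sumL ys (λ y → sumL xs (λ x → w x y))
sumL-comm []       ys w = sym (sumL-zero ys)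
sumL-comm (x ∷ xs) ys w =
  trans (cong (sumL ys (w x) +_) (sumL-comm xs ys w)) (sym (sumL-+ ys (w x) _))

sumL-++ : (xs ys : List X) (w : X → ℕ) → sumL (xs ++ ys) w ≡ sumL xs w + sumL ys w
sumL-++ []       ys w = refl
sumL-++ (x ∷ xs) ys w = trans (cong (w x +_) (sumL-++ xs ys w)) (sym (+-assoc (w x) _ _))

sumL-map : (g : X → Y) (xs : List X) (w : Y → ℕ) → sumL (map g xs) w ≡ sumL xs (w ∘ g)
sumL-map g []       w = refl
sumL-map g (x ∷ xs) w = cong (w (g x) +_) (sumL-map g xs w)

sumL-concatMap : (g : X → List Y) (xs : List X) (w : Y → ℕ) →
                 sumL (concatMap g xs) w ≡ sumL xs (λ x → sumL (g x) w)
sumL-concatMap g []       w = refl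
sumL-concatMap g (x ∷ xs) w =
  trans (sumL-++ (g x) (concatMap g xs) w) (cong (sumL (g x) w +_) (sumL-concatMap g xs w))

ind-∧ : ∀ a b → ind (a ∧ b) ≡ ind a * ind b
ind-∧ true  b = sym (+-identityʳ (ind b))
ind-∧ false b = refl

ind-not : ∀ a → ind a + ind (not a) ≡ 1
ind-not true  = refl
ind-not false = refl

∧-true : ∀ {a b} → (a ∧ b) ≡ true → (a ≡ true) × (b ≡ true)
∧-true {true} {true} refl = refl , refl

≡true⇒T : ∀ {b} → b ≡ true → T b
≡true⇒T refl = _

T⇒≡true : ∀ {b} → T b → b ≡ true
T⇒≡true {true} _ = refl

does⇒ : {P : Set} (P? : Dec P) → does P? ≡ true → P
does⇒ (yes p) _ = p

does≡ : {P : Set} (P? : Dec P) (b : Bool) → (P → b ≡ true) → (b ≡ true → P) → does P? ≡ b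
does≡ (yes p) true  _    _    = refl
does≡ (yes p) false to   _    = sym (to p)
does≡ (no ¬p) true  _    from = ⊥-elim (¬p (from refl))
does≡ (no ¬p) false _    _    = refl

OccursOnce : DecidableEquality X → List X → X → Set
OccursOnce _≟_ xs x = count (λ y → does (y ≟ x)) xs ≡ 1

sumL-delta : (_≟_ : DecidableEquality X) (ys : List X) (z : X) (w : X → ℕ) →
             sumL ys (λ y → ind (does (y ≟ z)) * w y) ≡ count (λ y → does (y ≟ z)) ys * w z
sumL-delta _≟_ ys z w = trans (sumL-cong ys pointwise) (sumL-*ʳ ys (w z) (λ y → ind (does (y ≟ z))))
  where
  pointwise : ∀ y → ind (does (y ≟ z)) * w y ≡ ind (does (y ≟ z)) * w z
  pointwise y with y ≟ z
  ... | yes refl = refl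
  ... | no  _    = refl

sumL-spread : (_≟_ : DecidableEquality Y) (xs : List X) (ys : List Y)
              (P : X → Bool) (Q : Y → Bool) (v : X → ℕ) (f : X → Y) →
              (∀ y → Q y ≡ true → OccursOnce _≟_ ys y) → (∀ x → P x ≡ true → Q (f x) ≡ true) →
              sumL xs (λ x → ind (P x) * v x) ≡
              sumL xs (λ x → sumL ys (λ y → ind (P x) * (ind (Q y) * (ind (does (y ≟ f x)) * v x))))
sumL-spread _≟_ xs ys P Q v f once PQ = sumL-cong xs pointwise
  where
  pointwise : ∀ x → ind (P x) * v x ≡ sumL ys (λ y → ind (P x) * (ind (Q y) * (ind (does (y ≟ f x)) * v x)))
  pointwise x with P x in Px
  ... | false = sym (sumL-zero ys)
  ... | true  = sym (begin
      sumL ys (λ y → 1 * (ind (Q y) * (ind (does (y ≟ f x)) * v x)))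
    ≡⟨ sumL-cong ys (λ y → trans (*-identityˡ _) (x*[y*z]≡y*[x*z] (ind (Q y)) (ind (does (y ≟ f x))) (v x))) ⟩
      sumL ys (λ y → ind (does (y ≟ f x)) * (ind (Q y) * v x))
    ≡⟨ sumL-delta _≟_ ys (f x) (λ y → ind (Q y) * v x) ⟩
      count (λ y → does (y ≟ f x)) ys * (ind (Q (f x)) * v x)
    ≡⟨ cong₂ (λ c q → c * (ind q * v x)) (once (f x) (PQ x Px)) (PQ x Px) ⟩
      1 * (1 * v x)
    ≡⟨ *-identityˡ (1 * v x) ⟩
      1 * v x ∎)
    where open ≡-Reasoning

-- Both sides are the sum over the pairs (x , y) with y = f x, equivalently x = g y.
sumL-bijection :
  (_≟X_ : DecidableEquality X) (_≟Y_ : DecidableEquality Y)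
  (xs : List X) (ys : List Y) (P : X → Bool) (Q : Y → Bool) (v : X → ℕ) (w : Y → ℕ)
  (f : X → Y) (g : Y → X) →
  (∀ x → P x ≡ true → OccursOnce _≟X_ xs x) →
  (∀ y → Q y ≡ true → OccursOnce _≟Y_ ys y) →
  (∀ x → P x ≡ true → Q (f x) ≡ true) →
  (∀ y → Q y ≡ true → P (g y) ≡ true) →
  (∀ x → P x ≡ true → g (f x) ≡ x) →
  (∀ y → Q y ≡ true → f (g y) ≡ y) →
  (∀ x → P x ≡ true → w (f x) ≡ v x) →
  sumL xs (λ x → ind (P x) * v x) ≡ sumL ys (λ y → ind (Q y) * w y)
sumL-bijection _≟X_ _≟Y_ xs ys P Q v w f g once-xs once-ys PQ QP gf fg wf =
  begin
    sumL xs (λ x → ind (P x) * v x)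
  ≡⟨ sumL-spread _≟Y_ xs ys P Q v f once-ys PQ ⟩
    sumL xs (λ x → sumL ys (λ y → ind (P x) * (ind (Q y) * (ind (does (y ≟Y f x)) * v x))))
  ≡⟨ sumL-cong xs (λ x → sumL-cong ys (λ y → symmetric x y)) ⟩
    sumL xs (λ x → sumL ys (λ y → ind (Q y) * (ind (P x) * (ind (does (x ≟X g y)) * w y))))
  ≡⟨ sumL-comm xs ys _ ⟩
    sumL ys (λ y → sumL xs (λ x → ind (Q y) * (ind (P x) * (ind (does (x ≟X g y)) * w y))))
  ≡⟨ sumL-spread _≟X_ ys xs Q P w g once-xs QP ⟨
    sumL ys (λ y → ind (Q y) * w y) ∎
  where
  open ≡-Reasoning

  symmetric : ∀ x y → ind (P x) * (ind (Q y) * (ind (does (y ≟Y f x)) * v x))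
                    ≡ ind (Q y) * (ind (P x) * (ind (does (x ≟X g y)) * w y))
  symmetric x y with P x in Px | Q y in Qy
  ... | false | false = refl
  ... | false | true  = refl
  ... | true  | false = refl
  ... | true  | true with y ≟Y f x | x ≟X g y
  ... | yes y≡fx | yes _    = cong (λ z → 1 * (1 * (1 * z))) (sym (trans (cong w y≡fx) (wf x Px)))
  ... | yes y≡fx | no  x≢gy = ⊥-elim (x≢gy (sym (trans (cong g y≡fx) (gf x Px))))
  ... | no  y≢fx | yes x≡gy = ⊥-elim (y≢fx (sym (trans (cong f x≡gy) (fg y Qy))))
  ... | no  _    | no  _    = refl

count-bijection :
  (_≟X_ : DecidableEquality X) (_≟Y_ : DecidableEquality Y)
  (xs : List X) (ys : List Y) (P : X → Bool) (Q : Y → Bool) (f : X → Y) (g : Y → X) →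
  (∀ x → P x ≡ true → OccursOnce _≟X_ xs x) →
  (∀ y → Q y ≡ true → OccursOnce _≟Y_ ys y) →
  (∀ x → P x ≡ true → Q (f x) ≡ true) →
  (∀ y → Q y ≡ true → P (g y) ≡ true) →
  (∀ x → P x ≡ true → g (f x) ≡ x) →
  (∀ y → Q y ≡ true → f (g y) ≡ y) →
  count P xs ≡ count Q ys
count-bijection _≟X_ _≟Y_ xs ys P Q f g once-xs once-ys PQ QP gf fg =
  trans (sumL-cong xs (λ x → sym (*-identityʳ (ind (P x)))))
    (trans (sumL-bijection _≟X_ _≟Y_ xs ys P Q (λ _ → 1) (λ _ → 1) f g once-xs once-ys PQ QP gf fg (λ _ _ → refl))
      (sumL-cong ys (λ y → *-identityʳ (ind (Q y)))))

sumF : (k : ℕ) → (Fin k → ℕ) → ℕ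
sumF zero    w = 0
sumF (suc k) w = w zero + sumF k (w ∘ suc)

prodF : (k : ℕ) → (Fin k → ℕ) → ℕ
prodF zero    w = 1
prodF (suc k) w = w zero * prodF k (w ∘ suc)

sumF-cong : (k : ℕ) {v w : Fin k → ℕ} → (∀ i → v i ≡ w i) → sumF k v ≡ sumF k w
sumF-cong zero    e = refl
sumF-cong (suc k) e = cong₂ _+_ (e zero) (sumF-cong k (e ∘ suc))

prodF-cong : (k : ℕ) {v w : Fin k → ℕ} → (∀ i → v i ≡ w i) → prodF k v ≡ prodF k w
prodF-cong zero    e = refl
prodF-cong (suc k) e = cong₂ _*_ (e zero) (prodF-cong k (e ∘ suc))

sumF-const : ∀ k c → sumF k (λ _ → c) ≡ k * c
sumF-const zero    c = refl
sumF-const (suc k) c = cong (c +_) (sumF-const k c)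

prodF-^-* : ∀ k u v (f g : Fin k → ℕ) →
            prodF k (λ i → u ^ f i * v ^ g i) ≡ u ^ sumF k f * v ^ sumF k g
prodF-^-* zero    u v f g = refl
prodF-^-* (suc k) u v f g = begin
    u ^ f zero * v ^ g zero * prodF k (λ i → u ^ f (suc i) * v ^ g (suc i))
  ≡⟨ cong (u ^ f zero * v ^ g zero *_) (prodF-^-* k u v (f ∘ suc) (g ∘ suc)) ⟩
    u ^ f zero * v ^ g zero * (u ^ sumF k (f ∘ suc) * v ^ sumF k (g ∘ suc))
  ≡⟨ *-interchange (u ^ f zero) (v ^ g zero) _ _ ⟩
    u ^ f zero * u ^ sumF k (f ∘ suc) * (v ^ g zero * v ^ sumF k (g ∘ suc))
  ≡⟨ cong₂ _*_ (^-distribˡ-+-* u (f zero) _) (^-distribˡ-+-* v (g zero) _) ⟨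
    u ^ sumF (suc k) f * v ^ sumF (suc k) g ∎
  where open ≡-Reasoning

sumL-tabulate : (k : ℕ) (g : Fin k → X) (w : X → ℕ) → sumL (tabulate g) w ≡ sumF k (w ∘ g)
sumL-tabulate zero    g w = refl
sumL-tabulate (suc k) g w = cong (w (g zero) +_) (sumL-tabulate k (g ∘ suc) w)

sumL-allFin : (k : ℕ) (w : Fin k → ℕ) → sumL (allFin k) w ≡ sumF k w
sumL-allFin k w = sumL-tabulate k (λ i → i) w

allFin-once : (k : ℕ) (a : Fin k) → OccursOnce _≟ᶠ_ (allFin k) a
allFin-once (suc k) zero    = cong suc (trans (sumL-tabulate k suc _) (sumF-zero k))
  where
  sumF-zero : ∀ k → sumF k (λ i → ind (does (suc i ≟ᶠ zero {k}))) ≡ 0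
  sumF-zero zero    = refl
  sumF-zero (suc k) = sumF-zero k
allFin-once (suc k) (suc a) =
  trans (sumL-tabulate k suc _) (trans (sym (sumL-allFin k _)) (allFin-once k a))

count-allFin-true : ∀ m (P : Fin m → Bool) → (∀ t → P t ≡ true) → count P (allFin m) ≡ m
count-allFin-true m P all = trans (sumL-allFin m _) (trans (sumF-cong m (λ t → cong ind (all t)))
  (trans (sumF-const m 1) (*-identityʳ m)))

range : ℕ → List ℕ
range zero    = []
range (suc k) = 0 ∷ map suc (range k)

upTo≡range : ∀ k → upTo k ≡ range k
upTo≡range k = trans (applyUpTo≡ (λ i → i) k) (Listₚ.map-id (range k))
  where
  applyUpTo≡ : (f : ℕ → ℕ) (k : ℕ) → applyUpTo f k ≡ map f (range k)
  applyUpTo≡ f zero    = refl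
  applyUpTo≡ f (suc k) = cong (f 0 ∷_) (trans (applyUpTo≡ (f ∘ suc) k) (Listₚ.map-∘ (range k)))

range-once : ∀ k j → j < k → OccursOnce _≟ℕ_ (range k) j
range-once (suc k) zero    _         = cong suc (trans (sumL-map suc (range k) _) (sumL-zero (range k)))
range-once (suc k) (suc j) (s≤s j<k) = trans (sumL-map suc (range k) _) (range-once k j j<k)

sumL-range-<ᵇ : ∀ k w → sumL (range k) (λ j → ind (j <ᵇ k) * w) ≡ k * w
sumL-range-<ᵇ zero    w = refl
sumL-range-<ᵇ (suc k) w = cong₂ _+_ (+-identityʳ w) (trans (sumL-map suc (range k) _) (sumL-range-<ᵇ k w))

sumL-allFin-toℕ : ∀ k (h : ℕ → ℕ) → sumL (allFin k) (h ∘ toℕ) ≡ sumL (range k) h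
sumL-allFin-toℕ k h = trans (sumL-allFin k _) (go k h)
  where
  go : ∀ k (h : ℕ → ℕ) → sumF k (h ∘ toℕ) ≡ sumL (range k) h
  go zero    h = refl
  go (suc k) h = cong (h 0 +_) (trans (go k (h ∘ suc)) (sym (sumL-map suc (range k) h)))

sumL-range-cong : ∀ k {v w : ℕ → ℕ} → (∀ i → i < k → v i ≡ w i) → sumL (range k) v ≡ sumL (range k) w
sumL-range-cong zero    h = refl
sumL-range-cong (suc k) {v} {w} h = cong₂ _+_ (h 0 (s≤s z≤n))
  (trans (sumL-map suc (range k) v) (trans (sumL-range-cong k (λ i i<k → h (suc i) (s≤s i<k))) (sym (sumL-map suc (range k) w))))

sumL-range-suc : ∀ k (h : ℕ → ℕ) → sumL (range (suc k)) h ≡ sumL (range k) h + h k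
sumL-range-suc zero    h = +-identityʳ (h 0)
sumL-range-suc (suc k) h = begin
    h 0 + sumL (map suc (range (suc k))) h     ≡⟨ cong (h 0 +_) (sumL-map suc (range (suc k)) h) ⟩
    h 0 + sumL (range (suc k)) (h ∘ suc)       ≡⟨ cong (h 0 +_) (sumL-range-suc k (h ∘ suc)) ⟩
    h 0 + (sumL (range k) (h ∘ suc) + h (suc k)) ≡⟨ +-assoc (h 0) _ _ ⟨
    h 0 + sumL (range k) (h ∘ suc) + h (suc k)   ≡⟨ cong (λ z → h 0 + z + h (suc k)) (sumL-map suc (range k) h) ⟨
    h 0 + sumL (map suc (range k)) h + h (suc k) ∎
  where open ≡-Reasoning

sumL-range-rotate : ∀ k (h : ℕ → ℕ) → h 0 ≡ h k → sumL (range k) h ≡ sumL (map suc (range k)) h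
sumL-range-rotate zero    h _   = refl
sumL-range-rotate (suc k) h h0≡hk = begin
    h 0 + sumL (map suc (range k)) h           ≡⟨ cong (h 0 +_) (sumL-map suc (range k) h) ⟩
    h 0 + sumL (range k) (h ∘ suc)             ≡⟨ +-comm (h 0) _ ⟩
    sumL (range k) (h ∘ suc) + h 0             ≡⟨ cong (sumL (range k) (h ∘ suc) +_) h0≡hk ⟩
    sumL (range k) (h ∘ suc) + h (suc k)       ≡⟨ sumL-range-suc k (h ∘ suc) ⟨
    sumL (range (suc k)) (h ∘ suc)             ≡⟨ sumL-map suc (range (suc k)) h ⟨
    sumL (map suc (range (suc k))) h           ∎
  where open ≡-Reasoning

suc-range-once : ∀ k x → 0 < x → x ≤ k → OccursOnce _≟ℕ_ (map suc (range k)) x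
suc-range-once k (suc x) _ x<k = trans (sumL-map suc (range k) _) (range-once k x x<k)

_≟ᶜ_ : ∀ {n} → DecidableEquality (Cell n)
(x , y) ≟ᶜ (x′ , y′) =
  map′ (λ (p , q) → cong₂ _,_ p q) (λ { refl → refl , refl })
    (x ≟ᶠ x′ ×-dec y ≟ᶠ y′)

cellCode : ∀ {n} → Cell n → ℕ
cellCode (x , y) = toℕ (combine x y)

cellCode-injective : ∀ {n} (c d : Cell n) → cellCode c ≡ cellCode d → c ≡ d
cellCode-injective {n} (x , y) (x′ , y′) e = begin
  (x , y)                    ≡⟨ Finₚ.remQuot-combine x y ⟨
  remQuot n (combine x y)    ≡⟨ cong (remQuot n) (Finₚ.toℕ-injective e) ⟩
  remQuot n (combine x′ y′)  ≡⟨ Finₚ.remQuot-combine x′ y′ ⟩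
  (x′ , y′)                  ∎
  where open ≡-Reasoning

cells : (n : ℕ) → List (Cell n)
cells n = concatMap (λ x → map (x ,_) (allFin n)) (allFin n)

sumL-cells : (n : ℕ) (w : Cell n → ℕ) → sumL (cells n) w ≡ sumL (allFin n) (λ x → sumL (allFin n) (λ y → w (x , y)))
sumL-cells n w = trans (sumL-concatMap _ (allFin n) w) (sumL-cong (allFin n) (λ x → sumL-map (x ,_) (allFin n) w))

sumL-cells-const : (n c : ℕ) → sumL (cells n) (λ _ → c) ≡ n * (n * c)
sumL-cells-const n c =
  trans (sumL-cells n _) (trans (sumL-allFin n _) (trans (sumF-cong n (λ _ → trans (sumL-allFin n _) (sumF-const n c)))
    (sumF-const n (n * c))))

sumL-cells≡sumF : (n : ℕ) (w : Cell n → ℕ) → sumL (cells n) w ≡ sumF n (λ x → sumF n (λ y → w (x , y)))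
sumL-cells≡sumF n w =
  trans (sumL-cells n w) (trans (sumL-allFin n _) (sumF-cong n (λ x → sumL-allFin n (λ y → w (x , y)))))

cells-once : (n : ℕ) (c : Cell n) → OccursOnce _≟ᶜ_ (cells n) c
cells-once n (a , b) = begin
    count (λ c → does (c ≟ᶜ (a , b))) (cells n)
  ≡⟨ sumL-cells n _ ⟩
    sumL (allFin n) (λ x → sumL (allFin n) (λ y → ind (does (x ≟ᶠ a) ∧ does (y ≟ᶠ b))))
  ≡⟨ sumL-cong (allFin n) (λ x → trans (sumL-cong (allFin n) (λ y → ind-∧ (does (x ≟ᶠ a)) _))
       (sumL-*ˡ (allFin n) (ind (does (x ≟ᶠ a))) (λ y → ind (does (y ≟ᶠ b))))) ⟩
    sumL (allFin n) (λ x → ind (does (x ≟ᶠ a)) * count (λ y → does (y ≟ᶠ b)) (allFin n))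
  ≡⟨ sumL-*ʳ (allFin n) _ _ ⟩
    count (λ x → does (x ≟ᶠ a)) (allFin n) * count (λ y → does (y ≟ᶠ b)) (allFin n)
  ≡⟨ cong₂ _*_ (allFin-once n a) (allFin-once n b) ⟩
    1 ∎
  where open ≡-Reasoning

module _ {A : Set} where

  allVecs-once : (_≟_ : DecidableEquality A) (xs : List A) → (∀ a → OccursOnce _≟_ xs a) →
                 ∀ k (v : Vec A k) → OccursOnce (Vecₚ.≡-dec _≟_) (allVecs xs k) v
  allVecs-once _≟_ xs once zero    []ᵛ       = refl
  allVecs-once _≟_ xs once (suc k) (a ∷ᵛ v) = begin
      count (λ u → does (Vecₚ.≡-dec _≟_ u (a ∷ᵛ v))) (concatMap (λ x → map (x ∷ᵛ_) (allVecs xs k)) xs)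
    ≡⟨ sumL-concatMap _ xs _ ⟩
      sumL xs (λ x → sumL (map (x ∷ᵛ_) (allVecs xs k)) (λ u → ind (does (Vecₚ.≡-dec _≟_ u (a ∷ᵛ v)))))
    ≡⟨ sumL-cong xs (λ x → trans (sumL-map (x ∷ᵛ_) (allVecs xs k) _)
         (trans (sumL-cong (allVecs xs k) (λ u → ind-∧ (does (x ≟ a)) _))
           (sumL-*ˡ (allVecs xs k) (ind (does (x ≟ a))) (λ u → ind (does (Vecₚ.≡-dec _≟_ u v)))))) ⟩
      sumL xs (λ x → ind (does (x ≟ a)) * count (λ u → does (Vecₚ.≡-dec _≟_ u v)) (allVecs xs k))
    ≡⟨ sumL-*ʳ xs _ _ ⟩
      count (λ x → does (x ≟ a)) xs * count (λ u → does (Vecₚ.≡-dec _≟_ u v)) (allVecs xs k)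
    ≡⟨ cong₂ _*_ (once a) (allVecs-once _≟_ xs once k v) ⟩
      1 ∎
    where open ≡-Reasoning

  allᵛ : {k : ℕ} → (Fin k → A → Bool) → Vec A k → Bool
  allᵛ P []ᵛ       = true
  allᵛ P (a ∷ᵛ v) = P zero a ∧ allᵛ (P ∘ suc) v

  count-allᵛ : (xs : List A) (k : ℕ) (P : Fin k → A → Bool) →
               count (allᵛ P) (allVecs xs k) ≡ prodF k (λ i → count (P i) xs)
  count-allᵛ xs zero    P = refl
  count-allᵛ xs (suc k) P = begin
      count (allᵛ P) (concatMap (λ x → map (x ∷ᵛ_) (allVecs xs k)) xs)
    ≡⟨ sumL-concatMap _ xs _ ⟩
      sumL xs (λ x → sumL (map (x ∷ᵛ_) (allVecs xs k)) (λ u → ind (allᵛ P u)))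
    ≡⟨ sumL-cong xs (λ x → trans (sumL-map (x ∷ᵛ_) (allVecs xs k) _)
         (trans (sumL-cong (allVecs xs k) (λ u → ind-∧ (P zero x) _))
           (sumL-*ˡ (allVecs xs k) (ind (P zero x)) (λ u → ind (allᵛ (P ∘ suc) u))))) ⟩
      sumL xs (λ x → ind (P zero x) * count (allᵛ (P ∘ suc)) (allVecs xs k))
    ≡⟨ sumL-*ʳ xs _ _ ⟩
      count (P zero) xs * count (allᵛ (P ∘ suc)) (allVecs xs k)
    ≡⟨ cong (count (P zero) xs *_) (count-allᵛ xs k (P ∘ suc)) ⟩
      prodF (suc k) (λ i → count (P i) xs) ∎
    where open ≡-Reasoning

  allᵛ-sound : {k : ℕ} (P : Fin k → A → Bool) (v : Vec A k) → allᵛ P v ≡ true → ∀ i → P i (lookup v i) ≡ true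
  allᵛ-sound P (a ∷ᵛ v) h zero    = proj₁ (∧-true h)
  allᵛ-sound P (a ∷ᵛ v) h (suc i) = allᵛ-sound (P ∘ suc) v (proj₂ (∧-true {P zero a} h)) i

  allᵛ-complete : {k : ℕ} (P : Fin k → A → Bool) (v : Vec A k) → (∀ i → P i (lookup v i) ≡ true) → allᵛ P v ≡ true
  allᵛ-complete P []ᵛ       h = refl
  allᵛ-complete P (a ∷ᵛ v) h rewrite h zero = allᵛ-complete (P ∘ suc) v (h ∘ suc)

_≟ᵗ_ : ∀ {n m} → DecidableEquality (Tiling n m)
_≟ᵗ_ = Vecₚ.≡-dec (Vecₚ.≡-dec _≟ᶠ_)

allTilings-once : ∀ n m (τ : Tiling n m) → OccursOnce _≟ᵗ_ (allTilings n m) τ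
allTilings-once n m = allVecs-once (Vecₚ.≡-dec _≟ᶠ_) (allVecs (allFin m) n)
                        (allVecs-once _≟ᶠ_ (allFin m) (allFin-once m) n) n

allTilings-empty : ∀ n .{{_ : NonZero n}} → allTilings n 0 ≡ []
allTilings-empty (suc n) = refl

tabulateTiling : ∀ {n m} → (Cell n → Fin m) → Tiling n m
tabulateTiling h = Vec.tabulate (λ x → Vec.tabulate (λ y → h (x , y)))

tileAt-tabulate : ∀ {n m} (h : Cell n → Fin m) (c : Cell n) → tileAt (tabulateTiling h) c ≡ h c
tileAt-tabulate h (x , y) = trans (cong (λ row → lookup row y) (Vecₚ.lookup∘tabulate _ x)) (Vecₚ.lookup∘tabulate _ y)

tiling-ext : ∀ {n m} {τ τ′ : Tiling n m} → (∀ c → tileAt τ c ≡ tileAt τ′ c) → τ ≡ τ′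
tiling-ext h = vec-ext (λ x → vec-ext (λ y → h (x , y)))
  where
  vec-ext : {k : ℕ} {u v : Vec X k} → (∀ i → lookup u i ≡ lookup v i) → u ≡ v
  vec-ext {u = u} {v} h = trans (sym (Vecₚ.tabulate∘lookup u)) (trans (Vecₚ.tabulate-cong h) (Vecₚ.tabulate∘lookup v))

equivariantᵇ : ∀ {n m} → (Cell n → Cell n) → (Fin m → Fin m) → Tiling n m → Bool
equivariantᵇ φ ψ τ = allᵛ (λ x row → allᵛ (λ y t → does (tileAt τ (φ (x , y)) ≟ᶠ ψ t)) row) τ

Equivariant : ∀ {n m} → (Cell n → Cell n) → (Fin m → Fin m) → Tiling n m → Set
Equivariant φ ψ τ = ∀ c → tileAt τ (φ c) ≡ ψ (tileAt τ c)

equivariantᵇ-sound : ∀ {n m} (φ : Cell n → Cell n) (ψ : Fin m → Fin m) τ →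
                     equivariantᵇ φ ψ τ ≡ true → Equivariant φ ψ τ
equivariantᵇ-sound φ ψ τ h (x , y) =
  does⇒ (_ ≟ᶠ _) (allᵛ-sound _ (lookup τ x) (allᵛ-sound _ τ h x) y)

equivariantᵇ-complete : ∀ {n m} (φ : Cell n → Cell n) (ψ : Fin m → Fin m) τ →
                        Equivariant φ ψ τ → equivariantᵇ φ ψ τ ≡ true
equivariantᵇ-complete φ ψ τ h =
  allᵛ-complete _ τ (λ x → allᵛ-complete _ (lookup τ x) (λ y → dec-true (_ ≟ᶠ _) (h (x , y))))

iterate-+ : (i j : ℕ) (h : X → X) (a : X) → iterate (i + j) h a ≡ iterate j h (iterate i h a)
iterate-+ zero    j h a = refl
iterate-+ (suc i) j h a = iterate-+ i j h (h a)

iterate-suc : (j : ℕ) (h : X → X) (a : X) → iterate (suc j) h a ≡ h (iterate j h a)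
iterate-suc zero    h a = refl
iterate-suc (suc j) h a = iterate-suc j h (h a)

iterate-intertwine : (φ : X → X) (ψ : Y → Y) (h : X → Y) → (∀ a → h (φ a) ≡ ψ (h a)) →
                     ∀ j a → h (iterate j φ a) ≡ iterate j ψ (h a)
iterate-intertwine φ ψ h e zero    a = refl
iterate-intertwine φ ψ h e (suc j) a = trans (iterate-intertwine φ ψ h e j (φ a)) (cong (iterate j ψ) (e a))

argmin : (ℕ → ℕ) → ℕ → ℕ
argmin f zero          = 0
argmin f (suc zero)    = 0
argmin f (suc (suc k)) = if f (suc k) <ᵇ f (argmin f (suc k)) then suc k else argmin f (suc k)

argmin-< : (f : ℕ → ℕ) (k : ℕ) → 0 < k → argmin f k < k
argmin-< f (suc zero)    _ = s≤s z≤n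
argmin-< f (suc (suc k)) _ = step (f (suc k) <ᵇ f (argmin f (suc k))) (argmin-< f (suc k) (s≤s z≤n))
  where
  step : ∀ b → argmin f (suc k) < suc k → (if b then suc k else argmin f (suc k)) < suc (suc k)
  step true  _  = ≤-refl
  step false lt = m<n⇒m<1+n lt

argmin-minimal : (f : ℕ → ℕ) (k i : ℕ) → i < k → f (argmin f k) ≤ f i
argmin-minimal f (suc zero)    zero    _         = ≤-refl
argmin-minimal f (suc zero)    (suc i) (s≤s ())
argmin-minimal f (suc (suc k)) i       (s≤s i≤k) =
  step (f (suc k) <ᵇ f (argmin f (suc k))) refl (argmin-minimal f (suc k))
  where
  step : ∀ b → (f (suc k) <ᵇ f (argmin f (suc k))) ≡ b → (∀ i → i < suc k → f (argmin f (suc k)) ≤ f i) →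
         f (if b then suc k else argmin f (suc k)) ≤ f i
  step true  test ih with m≤n⇒m<n∨m≡n i≤k
  ... | inj₁ i<k  = ≤-trans (<⇒≤ (<ᵇ⇒< _ _ (≡true⇒T test))) (ih i i<k)
  ... | inj₂ refl = ≤-refl
  step false test ih with m≤n⇒m<n∨m≡n i≤k
  ... | inj₁ i<k  = ih i i<k
  ... | inj₂ refl = ≮⇒≥ (λ lt → subst T test (<⇒<ᵇ lt))

-- Orbit representatives are the elements of least code on their orbit.
module Orbits {X : Set} (φ : X → X) (L : X → ℕ)
  (L-pos : ∀ c → 0 < L c) (iterate-L : ∀ c → iterate (L c) φ c ≡ c)
  (L-minimal : ∀ c j → 0 < j → j < L c → iterate j φ c ≢ c) (L-φ : ∀ c → L (φ c) ≡ L c)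
  (code : X → ℕ) (code-injective : ∀ c d → code c ≡ code d → c ≡ d) where

  L-iterate : ∀ j c → L (iterate j φ c) ≡ L c
  L-iterate zero    c = refl
  L-iterate (suc j) c = trans (L-iterate j (φ c)) (L-φ c)

  private
    no-repeat : ∀ c i j → i < j → j < L c → iterate i φ c ≢ iterate j φ c
    no-repeat c i j i<j j<L e = L-minimal c (i + (L c ∸ j)) pos lt (begin
        iterate (i + (L c ∸ j)) φ c             ≡⟨ iterate-+ i (L c ∸ j) φ c ⟩
        iterate (L c ∸ j) φ (iterate i φ c)     ≡⟨ cong (iterate (L c ∸ j) φ) e ⟩
        iterate (L c ∸ j) φ (iterate j φ c)     ≡⟨ iterate-+ j (L c ∸ j) φ c ⟨
        iterate (j + (L c ∸ j)) φ c             ≡⟨ cong (λ z → iterate z φ c) (m+[n∸m]≡n (<⇒≤ j<L)) ⟩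
        iterate (L c) φ c                       ≡⟨ iterate-L c ⟩
        c                                       ∎)
      where
      open ≡-Reasoning
      pos : 0 < i + (L c ∸ j)
      pos = ≤-trans (m<n⇒0<n∸m j<L) (m≤n+m (L c ∸ j) i)
      lt : i + (L c ∸ j) < L c
      lt = subst (i + (L c ∸ j) <_) (m+[n∸m]≡n (<⇒≤ j<L)) (+-monoˡ-< (L c ∸ j) i<j)

  iterate-injective : ∀ c i j → i < L c → j < L c → iterate i φ c ≡ iterate j φ c → i ≡ j
  iterate-injective c i j i<L j<L e with <-cmp i j
  ... | tri< i<j _ _ = ⊥-elim (no-repeat c i j i<j j<L e)
  ... | tri≈ _ i≡j _ = i≡j
  ... | tri> _ _ j<i = ⊥-elim (no-repeat c j i j<i i<L (sym e))

  private
    codeAlong : X → ℕ → ℕ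
    codeAlong c j = code (iterate j φ c)

    best : X → ℕ
    best c = argmin (codeAlong c) (L c)

    best-< : ∀ c → best c < L c
    best-< c = argmin-< (codeAlong c) (L c) (L-pos c)

  rep : X → X
  rep c = iterate (best c) φ c

  rep-φ : ∀ c → rep (φ c) ≡ rep c
  rep-φ c = code-injective _ _ (≤-antisym rep-φ≤rep rep≤rep-φ)
    where
    minimal-φ : ∀ i → i < L c → codeAlong (φ c) (best (φ c)) ≤ codeAlong (φ c) i
    minimal-φ i i<L = argmin-minimal (codeAlong (φ c)) (L (φ c)) i (subst (i <_) (sym (L-φ c)) i<L)

    L-1+1 : suc (L c ∸ 1) ≡ L c
    L-1+1 = m+[n∸m]≡n (L-pos c)

    rep-φ≤rep : codeAlong (φ c) (best (φ c)) ≤ codeAlong c (best c)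
    rep-φ≤rep with best c in eq
    ... | zero  = subst (codeAlong (φ c) (best (φ c)) ≤_)
                    (cong code (trans (cong (λ z → iterate z φ c) L-1+1) (iterate-L c)))
                    (minimal-φ (L c ∸ 1) (subst (L c ∸ 1 <_) L-1+1 ≤-refl))
    ... | suc b = minimal-φ b (<-trans (n<1+n b) (subst (_< L c) eq (best-< c)))

    rep≤rep-φ : codeAlong c (best c) ≤ codeAlong (φ c) (best (φ c))
    rep≤rep-φ with m≤n⇒m<n∨m≡n (subst (best (φ c) <_) (L-φ c) (best-< (φ c)))
    ... | inj₁ <L = argmin-minimal (codeAlong c) (L c) (suc (best (φ c))) <L
    ... | inj₂ ≡L = subst (codeAlong c (best c) ≤_)
                      (cong code (sym (trans (cong (λ z → iterate z φ c) ≡L) (iterate-L c))))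
                      (argmin-minimal (codeAlong c) (L c) 0 (L-pos c))

  rep-iterate : ∀ j c → rep (iterate j φ c) ≡ rep c
  rep-iterate zero    c = refl
  rep-iterate (suc j) c = trans (rep-iterate j (φ c)) (rep-φ c)

  rep-idem : ∀ c → rep (rep c) ≡ rep c
  rep-idem c = rep-iterate (best c) c

  L-rep : ∀ c → L (rep c) ≡ L c
  L-rep c = L-iterate (best c) c

  idx : X → ℕ
  idx c with best c
  ... | zero  = 0
  ... | suc b = L c ∸ suc b

  idx-< : ∀ c → idx c < L c
  idx-< c with best c in eq
  ... | zero  = L-pos c
  ... | suc b = ∸-monoʳ-< {L c} {suc b} {0} (s≤s z≤n) (<⇒≤ (subst (_< L c) eq (best-< c)))

  iterate-idx : ∀ c → iterate (idx c) φ (rep c) ≡ c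
  iterate-idx c with best c in eq
  ... | zero  = refl
  ... | suc b = trans (sym (iterate-+ (suc b) (L c ∸ suc b) φ c))
                  (trans (cong (λ z → iterate z φ c) (m+[n∸m]≡n (<⇒≤ (subst (_< L c) eq (best-< c))))) (iterate-L c))

  idx-rep : ∀ c → rep c ≡ c → idx c ≡ 0
  idx-rep c e = iterate-injective c (idx c) 0 (idx-< c) (L-pos c)
                  (trans (cong (iterate (idx c) φ) (sym e)) (iterate-idx c))

  private
    idx-φ-< : ∀ c → idx (φ c) < L (rep c)
    idx-φ-< c = subst (idx (φ c) <_) (trans (L-φ c) (sym (L-rep c))) (idx-< (φ c))

    iterate-idx-φ : ∀ c → iterate (idx (φ c)) φ (rep c) ≡ iterate (suc (idx c)) φ (rep c)
    iterate-idx-φ c = trans (cong (iterate (idx (φ c)) φ) (sym (rep-φ c)))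
      (trans (iterate-idx (φ c)) (sym (trans (iterate-suc (idx c) φ (rep c)) (cong φ (iterate-idx c)))))

  idx-φ-step : ∀ c → suc (idx c) < L c → idx (φ c) ≡ suc (idx c)
  idx-φ-step c lt = iterate-injective (rep c) _ _ (idx-φ-< c) (subst (suc (idx c) <_) (sym (L-rep c)) lt)
                      (iterate-idx-φ c)

  idx-φ-wrap : ∀ c → suc (idx c) ≡ L c → idx (φ c) ≡ 0
  idx-φ-wrap c e = iterate-injective (rep c) _ _ (idx-φ-< c) (L-pos (rep c))
    (trans (iterate-idx-φ c) (trans (cong (λ z → iterate z φ (rep c)) (trans e (sym (L-rep c)))) (iterate-L (rep c))))

module CellOrbits {n : ℕ} (φ : Cell n → Cell n) (L : Cell n → ℕ)
  (L-pos : ∀ c → 0 < L c) (iterate-L : ∀ c → iterate (L c) φ c ≡ c)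
  (L-minimal : ∀ c j → 0 < j → j < L c → iterate j φ c ≢ c) (L-φ : ∀ c → L (φ c) ≡ L c) where

  open Orbits φ L L-pos iterate-L L-minimal L-φ cellCode cellCode-injective public

  isRep : Cell n → Bool
  isRep c = does (rep c ≟ᶜ c)

  isRep-rep : ∀ c → isRep (rep c) ≡ true
  isRep-rep c = dec-true (rep (rep c) ≟ᶜ rep c) (rep-idem c)

  module _ (S : Cell n → Bool) (S-φ : ∀ c → S (φ c) ≡ S c) where

    S-iterate : ∀ j c → S (iterate j φ c) ≡ S c
    S-iterate zero    c = refl
    S-iterate (suc j) c = trans (S-iterate j (φ c)) (S-φ c)

    S-rep : ∀ c → S (rep c) ≡ S c
    S-rep c = trans (sym (S-iterate (idx c) (rep c))) (cong S (iterate-idx c))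

    -- c ↦ idx c is a bijection from the orbit of a representative r onto {0, …, L r - 1}.
    orbit-count : ∀ r → sumL (cells n) (λ c → ind (does (rep c ≟ᶜ r)) * ind (S c)) ≡ ind (S r ∧ isRep r) * L r
    orbit-count r with isRep r in r-isRep
    ... | false = trans (sumL-cong (cells n) not-in-orbit)
                    (trans (sumL-zero (cells n)) (cong (λ b → ind b * L r) (sym (∧-zeroʳ (S r)))))
      where
      not-in-orbit : ∀ c → ind (does (rep c ≟ᶜ r)) * ind (S c) ≡ 0
      not-in-orbit c = cong (λ b → ind b * ind (S c)) (dec-false (rep c ≟ᶜ r) rep≢r)
        where
        rep≢r : rep c ≢ r
        rep≢r e with trans (sym r-isRep) (trans (cong isRep (sym e)) (isRep-rep c))
        ... | ()
    ... | true = begin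
        sumL (cells n) (λ c → ind (does (rep c ≟ᶜ r)) * ind (S c))
      ≡⟨ sumL-bijection _≟ᶜ_ _≟ℕ_ (cells n) (range (L r)) (λ c → does (rep c ≟ᶜ r)) (λ j → j <ᵇ L r)
           (λ c → ind (S c)) (λ _ → ind (S r)) idx (λ j → iterate j φ r)
           (λ c _ → cells-once n c) (λ j j<L → range-once (L r) j (<ᵇ⇒< j (L r) (≡true⇒T j<L)))
           idx-<L (λ j _ → dec-true (rep (iterate j φ r) ≟ᶜ r) (trans (rep-iterate j r) rr))
           iterate-idx′ idx-iterate (λ c c∈ → cong ind (trans (cong S (sym (does⇒ (rep c ≟ᶜ r) c∈))) (S-rep c))) ⟩
        sumL (range (L r)) (λ j → ind (j <ᵇ L r) * ind (S r))
      ≡⟨ sumL-range-<ᵇ (L r) (ind (S r)) ⟩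
        L r * ind (S r)
      ≡⟨ *-comm (L r) _ ⟩
        ind (S r) * L r
      ≡⟨ cong (λ b → ind b * L r) (∧-identityʳ (S r)) ⟨
        ind (S r ∧ true) * L r ∎
      where
      open ≡-Reasoning
      rr : rep r ≡ r
      rr = does⇒ (rep r ≟ᶜ r) r-isRep
      idx-<L : ∀ c → does (rep c ≟ᶜ r) ≡ true → (idx c <ᵇ L r) ≡ true
      idx-<L c c∈ = T⇒≡true (<⇒<ᵇ (subst (idx c <_) (trans (sym (L-rep c)) (cong L (does⇒ (rep c ≟ᶜ r) c∈))) (idx-< c)))
      iterate-idx′ : ∀ c → does (rep c ≟ᶜ r) ≡ true → iterate (idx c) φ r ≡ c
      iterate-idx′ c c∈ = trans (cong (iterate (idx c) φ) (sym (does⇒ (rep c ≟ᶜ r) c∈))) (iterate-idx c)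
      idx-iterate : ∀ j → (j <ᵇ L r) ≡ true → idx (iterate j φ r) ≡ j
      idx-iterate j j<L = iterate-injective r _ j (subst (idx c <_) (L-iterate j r) (idx-< c)) (<ᵇ⇒< j (L r) (≡true⇒T j<L))
                            (trans (cong (iterate (idx c) φ) (sym (trans (rep-iterate j r) rr))) (iterate-idx c))
        where
        c : Cell n
        c = iterate j φ r

    count-by-orbits : sumL (cells n) (λ r → ind (S r ∧ isRep r) * L r) ≡ count S (cells n)
    count-by-orbits = sym (begin
        count S (cells n)
      ≡⟨ sumL-cong (cells n) (λ c → trans (sym (*-identityˡ (ind (S c))))
           (trans (cong (_* ind (S c)) (sym (cells-once n (rep c)))) (sym (sumL-*ʳ (cells n) (ind (S c)) _)))) ⟩
        sumL (cells n) (λ c → sumL (cells n) (λ r → ind (does (r ≟ᶜ rep c)) * ind (S c)))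
      ≡⟨ sumL-comm (cells n) (cells n) _ ⟩
        sumL (cells n) (λ r → sumL (cells n) (λ c → ind (does (r ≟ᶜ rep c)) * ind (S c)))
      ≡⟨ sumL-cong (cells n) (λ r → trans (sumL-cong (cells n) (λ c → cong (λ b → ind b * ind (S c)) (does-sym r (rep c))))
           (orbit-count r)) ⟩
        sumL (cells n) (λ r → ind (S r ∧ isRep r) * L r) ∎)
      where
      open ≡-Reasoning
      does-sym : ∀ c d → does (c ≟ᶜ d) ≡ does (d ≟ᶜ c)
      does-sym c d = does-⇔ (mk⇔ sym sym) (c ≟ᶜ d) (d ≟ᶜ c)

  -- For m ≥ 1 tiles, an equivariant tiling is determined by its values on the
  -- representatives, and the value t at a representative c is free subject to
  -- ψ^(L c) t = t.  Off the representatives we pad with the tile zero.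
  module EquivariantCount {m₀ : ℕ} (ψ : Fin (suc m₀) → Fin (suc m₀)) where

    m : ℕ
    m = suc m₀

    slot : Cell n → Fin m → Bool
    slot c t = if isRep c then does (iterate (L c) ψ t ≟ᶠ t) else does (t ≟ᶠ zero)

    slotsOk : Tiling n m → Bool
    slotsOk v = allᵛ (λ x row → allᵛ (λ y t → slot (x , y) t) row) v

    slotsOk-sound : ∀ v → slotsOk v ≡ true → ∀ c → slot c (tileAt v c) ≡ true
    slotsOk-sound v h (x , y) = allᵛ-sound _ (lookup v x) (allᵛ-sound _ v h x) y

    slotsOk-complete : ∀ v → (∀ c → slot c (tileAt v c) ≡ true) → slotsOk v ≡ true
    slotsOk-complete v h = allᵛ-complete _ v (λ x → allᵛ-complete _ (lookup v x) (λ y → h (x , y)))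

    restrict : Tiling n m → Tiling n m
    restrict τ = tabulateTiling (λ c → if isRep c then tileAt τ c else zero)

    extend : Tiling n m → Tiling n m
    extend v = tabulateTiling (λ c → iterate (idx c) ψ (tileAt v (rep c)))

    restrict-at-rep : ∀ τ c → tileAt (restrict τ) (rep c) ≡ tileAt τ (rep c)
    restrict-at-rep τ c = trans (tileAt-tabulate _ (rep c)) (cong (λ b → if b then tileAt τ (rep c) else zero) (isRep-rep c))

    extend-at : ∀ v c → tileAt (extend v) c ≡ iterate (idx c) ψ (tileAt v (rep c))
    extend-at v c = tileAt-tabulate (λ c → iterate (idx c) ψ (tileAt v (rep c))) c

    restrict-ok : ∀ τ → equivariantᵇ φ ψ τ ≡ true → slotsOk (restrict τ) ≡ true
    restrict-ok τ eq = slotsOk-complete (restrict τ) at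
      where
      at : ∀ c → slot c (tileAt (restrict τ) c) ≡ true
      at c rewrite tileAt-tabulate (λ c → if isRep c then tileAt τ c else zero) c with isRep c
      ... | true  = dec-true (_ ≟ᶠ _) (trans
                      (sym (iterate-intertwine φ ψ (tileAt τ) (equivariantᵇ-sound φ ψ τ eq) (L c) c))
                      (cong (tileAt τ) (iterate-L c)))
      ... | false = dec-true (zero {m₀} ≟ᶠ zero) refl

    extend-ok : ∀ v → slotsOk v ≡ true → equivariantᵇ φ ψ (extend v) ≡ true
    extend-ok v ok = equivariantᵇ-complete φ ψ (extend v) step
      where
      u : Cell n → Fin m
      u c = tileAt v (rep c)
      periodic : ∀ c → iterate (L c) ψ (u c) ≡ u c
      periodic c = trans (cong (λ z → iterate z ψ (u c)) (sym (L-rep c)))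
        (does⇒ (_ ≟ᶠ _) (subst (λ b → (if b then does (iterate (L (rep c)) ψ (u c) ≟ᶠ u c)
                                                 else does (u c ≟ᶠ zero)) ≡ true)
                                (isRep-rep c) (slotsOk-sound v ok (rep c))))
      step : ∀ c → tileAt (extend v) (φ c) ≡ ψ (tileAt (extend v) c)
      step c rewrite extend-at v (φ c) | extend-at v c | rep-φ c with m≤n⇒m<n∨m≡n (idx-< c)
      ... | inj₁ lt = trans (cong (λ z → iterate z ψ (u c)) (idx-φ-step c lt)) (iterate-suc (idx c) ψ (u c))
      ... | inj₂ eq = trans (cong (λ z → iterate z ψ (u c)) (idx-φ-wrap c eq))
                        (trans (sym (periodic c)) (trans (cong (λ z → iterate z ψ (u c)) (sym eq)) (iterate-suc (idx c) ψ (u c))))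

    extend∘restrict : ∀ τ → equivariantᵇ φ ψ τ ≡ true → extend (restrict τ) ≡ τ
    extend∘restrict τ eq = tiling-ext λ c → begin
        tileAt (extend (restrict τ)) c                   ≡⟨ extend-at (restrict τ) c ⟩
        iterate (idx c) ψ (tileAt (restrict τ) (rep c))  ≡⟨ cong (iterate (idx c) ψ) (restrict-at-rep τ c) ⟩
        iterate (idx c) ψ (tileAt τ (rep c))
          ≡⟨ iterate-intertwine φ ψ (tileAt τ) (equivariantᵇ-sound φ ψ τ eq) (idx c) (rep c) ⟨
        tileAt τ (iterate (idx c) φ (rep c))             ≡⟨ cong (tileAt τ) (iterate-idx c) ⟩
        tileAt τ c                                       ∎
      where open ≡-Reasoning

    restrict∘extend : ∀ v → slotsOk v ≡ true → restrict (extend v) ≡ v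
    restrict∘extend v ok = tiling-ext at
      where
      at : ∀ c → tileAt (restrict (extend v)) c ≡ tileAt v c
      at c with isRep c in c-isRep | slotsOk-sound v ok c
      ... | true | _ = trans (tileAt-tabulate _ c)
                         (trans (cong (λ b → if b then tileAt (extend v) c else zero) c-isRep)
                         (trans (extend-at v c) (trans (cong (λ z → iterate z ψ (tileAt v (rep c))) (idx-rep c rc))
                           (cong (tileAt v) rc))))
        where
        rc : rep c ≡ c
        rc = does⇒ (rep c ≟ᶜ c) c-isRep
      ... | false | v-zero = trans (tileAt-tabulate _ c)
                         (trans (cong (λ b → if b then tileAt (extend v) c else zero) c-isRep) (sym (does⇒ (_ ≟ᶠ _) v-zero)))

    choices : Cell n → ℕ
    choices c = if isRep c then count (λ t → does (iterate (L c) ψ t ≟ᶠ t)) (allFin m) else 1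

    count-equivariant : count (equivariantᵇ φ ψ) (allTilings n m) ≡ prodF n (λ x → prodF n (λ y → choices (x , y)))
    count-equivariant = begin
        count (equivariantᵇ φ ψ) (allTilings n m)
      ≡⟨ count-bijection _≟ᵗ_ _≟ᵗ_ (allTilings n m) (allTilings n m) (equivariantᵇ φ ψ) slotsOk restrict extend
           (λ τ _ → allTilings-once n m τ) (λ v _ → allTilings-once n m v)
           restrict-ok extend-ok extend∘restrict restrict∘extend ⟩
        count slotsOk (allTilings n m)
      ≡⟨ count-allᵛ (allVecs (allFin m) n) n _ ⟩
        prodF n (λ x → count (allᵛ (λ y t → slot (x , y) t)) (allVecs (allFin m) n))
      ≡⟨ prodF-cong n (λ x → trans (count-allᵛ (allFin m) n _) (prodF-cong n (λ y → count-slot (x , y)))) ⟩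
        prodF n (λ x → prodF n (λ y → choices (x , y))) ∎
      where
      open ≡-Reasoning
      count-slot : ∀ c → count (slot c) (allFin m) ≡ choices c
      count-slot c with isRep c
      ... | true  = refl
      ... | false = allFin-once m zero

module ModArith (n : ℕ) .{{_ : NonZero n}} where

  %-+ˡ : ∀ a b → (a % n + b) % n ≡ (a + b) % n
  %-+ˡ a b = trans (%-distribˡ-+ (a % n) b n) (trans (cong (λ z → (z + b % n) % n) (m%n%n≡m%n a n)) (sym (%-distribˡ-+ a b n)))

  %-+ʳ : ∀ a b → (a + b % n) % n ≡ (a + b) % n
  %-+ʳ a b = trans (cong (_% n) (+-comm a (b % n))) (trans (%-+ˡ b a) (cong (_% n) (+-comm b a)))

  +-cancelʳ-% : ∀ a b t → (a + t) % n ≡ (b + t) % n → a % n ≡ b % n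
  +-cancelʳ-% a b t h = begin
      a % n                               ≡⟨ [m+n]%n≡m%n a n ⟨
      (a + n) % n                         ≡⟨ cong (λ z → (a + z) % n) t+[n∸t]≡n ⟨
      (a + (t % n + (n ∸ t % n))) % n     ≡⟨ cong (_% n) (+-assoc a (t % n) _) ⟨
      (a + t % n + (n ∸ t % n)) % n       ≡⟨ %-+ˡ (a + t % n) _ ⟨
      ((a + t % n) % n + (n ∸ t % n)) % n ≡⟨ cong (λ z → (z + (n ∸ t % n)) % n) a+t≡b+t ⟩
      ((b + t % n) % n + (n ∸ t % n)) % n ≡⟨ %-+ˡ (b + t % n) _ ⟩
      (b + t % n + (n ∸ t % n)) % n       ≡⟨ cong (_% n) (+-assoc b (t % n) _) ⟩
      (b + (t % n + (n ∸ t % n))) % n     ≡⟨ cong (λ z → (b + z) % n) t+[n∸t]≡n ⟩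
      (b + n) % n                         ≡⟨ [m+n]%n≡m%n b n ⟩
      b % n                               ∎
    where
    open ≡-Reasoning
    t+[n∸t]≡n : t % n + (n ∸ t % n) ≡ n
    t+[n∸t]≡n = m+[n∸m]≡n (m%n≤n t n)
    a+t≡b+t : (a + t % n) % n ≡ (b + t % n) % n
    a+t≡b+t = trans (%-+ʳ a t) (trans h (sym (%-+ʳ b t)))

  +-%-fixed⇒∣ : ∀ a t → a < n → (a + t) % n ≡ a → n ∣ t
  +-%-fixed⇒∣ a t a<n h = m%n≡0⇒n∣m t n (trans (+-cancelʳ-% t 0 a (begin
      (t + a) % n   ≡⟨ cong (_% n) (+-comm t a) ⟩
      (a + t) % n   ≡⟨ h ⟩
      a             ≡⟨ m<n⇒m%n≡m a<n ⟨
      a % n         ∎)) (m<n⇒m%n≡m (>-nonZero⁻¹ n)))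
    where open ≡-Reasoning

  gcd-nonZero : ∀ k → NonZero (gcd k n)
  gcd-nonZero k = ≢-nonZero (gcd[m,n]≢0 k n (inj₂ (≢-nonZero⁻¹ n)))

  ord : ℕ → ℕ
  ord k = (n / gcd k n) {{gcd-nonZero k}}

  module _ (k : ℕ) where
    private instance _ = gcd-nonZero k

    ord*gcd≡n : ord k * gcd k n ≡ n
    ord*gcd≡n = m/n*n≡m (gcd[m,n]∣n k n)

    ord-pos : 0 < ord k
    ord-pos = m≥n⇒m/n>0 (gcd[m,n]≤n k n)

    ord∣n : ord k ∣ n
    ord∣n = divides (gcd k n) (trans (sym ord*gcd≡n) (*-comm (ord k) (gcd k n)))

    n∣ord*k : n ∣ ord k * k
    n∣ord*k = divides (k / gcd k n) (begin
        ord k * k                           ≡⟨ cong (ord k *_) (m/n*n≡m (gcd[m,n]∣m k n)) ⟨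
        ord k * (k / gcd k n * gcd k n)     ≡⟨ cong (ord k *_) (*-comm (k / gcd k n) (gcd k n)) ⟩
        ord k * (gcd k n * (k / gcd k n))   ≡⟨ *-assoc (ord k) (gcd k n) _ ⟨
        ord k * gcd k n * (k / gcd k n)     ≡⟨ cong (_* (k / gcd k n)) ord*gcd≡n ⟩
        n * (k / gcd k n)                   ≡⟨ *-comm n _ ⟩
        k / gcd k n * n                     ∎)
      where open ≡-Reasoning

    -- ord k and k / gcd k n are coprime
    n∣j*k⇒ord∣j : ∀ j → n ∣ j * k → ord k ∣ j
    n∣j*k⇒ord∣j j n∣jk = coprime-divisor (Coprimality.sym (coprime-/gcd k n)) (*-cancelʳ-∣ (gcd k n)
      (subst₂ _∣_ (sym ord*gcd≡n)
        (trans (cong (j *_) (sym (m/n*n≡m (gcd[m,n]∣m k n))))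
          (trans (sym (*-assoc j (k / gcd k n) _)) (cong (_* gcd k n) (*-comm j _))))
        n∣jk))

  ord-% : ∀ k → ord (k % n) ≡ ord k
  ord-% k = /-congʳ {{gcd-nonZero (k % n)}} {{gcd-nonZero k}} gcd-%
    where
    gcd-% : gcd (k % n) n ≡ gcd k n
    gcd-% = ∣-antisym
      (gcd-greatest (∣n∣m%n⇒∣m (gcd[m,n]∣n (k % n) n) (gcd[m,n]∣m (k % n) n)) (gcd[m,n]∣n (k % n) n))
      (gcd-greatest (%-presˡ-∣ (gcd[m,n]∣m k n) (gcd[m,n]∣n k n)) (gcd[m,n]∣n k n))

data Parity : ℕ → Set where
  even : ∀ i → Parity (2 * i)
  odd  : ∀ i → Parity (suc (2 * i))

parity : ∀ j → Parity j
parity zero = even 0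
parity (suc j) with parity j
... | even i = odd i
... | odd  i = subst Parity (cong suc (+-suc i (i + 0))) (even (suc i))

isOdd-even : ∀ i → isOdd (2 * i) ≡ false
isOdd-even i = cong (_≡ᵇ 1) (trans (cong (_% 2) (*-comm 2 i)) (m*n%n≡0 i 2))

isOdd-odd : ∀ i → isOdd (suc (2 * i)) ≡ true
isOdd-odd i = cong (_≡ᵇ 1) (trans (cong (λ z → (1 + z) % 2) (*-comm 2 i)) ([m+kn]%n≡m%n 1 i 2))

odd-view : ∀ j → isOdd j ≡ true → ∃ λ i → j ≡ suc (2 * i)
odd-view j h with parity j
... | odd  i = i , refl
... | even i with trans (sym h) (isOdd-even i)
...   | ()

iterate-involution-even : (ψ : X → X) → (∀ t → ψ (ψ t) ≡ t) → ∀ i t → iterate (2 * i) ψ t ≡ t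
iterate-involution-even ψ ψψ zero    t = refl
iterate-involution-even ψ ψψ (suc i) t =
  trans (cong (λ j → iterate j ψ t) (*-suc 2 i)) (trans (iterate-involution-even ψ ψψ i (ψ (ψ t))) (ψψ t))

iterate-involution-odd : (ψ : X → X) → (∀ t → ψ (ψ t) ≡ t) → ∀ i t → iterate (suc (2 * i)) ψ t ≡ ψ t
iterate-involution-odd ψ ψψ i t = trans (iterate-suc (2 * i) ψ t) (cong ψ (iterate-involution-even ψ ψψ i t))

-- The cell map of ((a , b) , rf):  (x , y) ↦ (y + b , x + a)

module RfShift (n : ℕ) .{{_ : NonZero n}} (a b : Fin n) where
  open ModArith n

  A B k e : ℕ
  A = toℕ a
  B = toℕ b
  k = A + B
  e = ord k

  φ : Cell n → Cell n
  φ c = affAct c (a , b) rf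

  toℕ² : Cell n → ℕ × ℕ
  toℕ² (x , y) = toℕ x , toℕ y

  Φ : ℕ × ℕ → ℕ × ℕ
  Φ (X , Y) = (Y + B) % n , (X + A) % n

  toℕ²-φ : ∀ c → toℕ² (φ c) ≡ Φ (toℕ² c)
  toℕ²-φ (x , y) = cong₂ _,_ (trans (cong toℕ (Finₚ.opposite-involutive (y +ₙ b))) (Finₚ.toℕ-fromℕ< _))
                             (Finₚ.toℕ-fromℕ< _)

  toℕ²-injective : ∀ c d → toℕ² c ≡ toℕ² d → c ≡ d
  toℕ²-injective (x , y) (x′ , y′) h =
    cong₂ _,_ (Finₚ.toℕ-injective (cong proj₁ h)) (Finₚ.toℕ-injective (cong proj₂ h))

  Φ-even : ∀ i X Y → X < n → Y < n → iterate (2 * i) Φ (X , Y) ≡ ((X + i * k) % n , (Y + i * k) % n)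
  Φ-even zero    X Y X<n Y<n = cong₂ _,_ (sym (trans (cong (_% n) (+-identityʳ X)) (m<n⇒m%n≡m X<n)))
                                         (sym (trans (cong (_% n) (+-identityʳ Y)) (m<n⇒m%n≡m Y<n)))
  Φ-even (suc i) X Y X<n Y<n = begin
      iterate (2 * suc i) Φ (X , Y)
    ≡⟨ cong (λ j → iterate j Φ (X , Y)) (*-suc 2 i) ⟩
      iterate (2 * i) Φ (Φ (Φ (X , Y)))
    ≡⟨ Φ-even i _ _ (m%n<n _ n) (m%n<n _ n) ⟩
      ((((X + A) % n + B) % n + i * k) % n , (((Y + B) % n + A) % n + i * k) % n)
    ≡⟨ cong₂ _,_ (trans (%-+ˡ-twice (X + A) B (i * k)) (cong (_% n) (shuffle X A B (i * k))))
                 (trans (%-+ˡ-twice (Y + B) A (i * k)) (cong (_% n) (shuffle′ Y A B (i * k)))) ⟩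
      ((X + suc i * k) % n , (Y + suc i * k) % n) ∎
    where
    open ≡-Reasoning
    %-+ˡ-twice : ∀ u p q → ((u % n + p) % n + q) % n ≡ (u + (p + q)) % n
    %-+ˡ-twice u p q = trans (%-+ˡ (u % n + p) q) (trans (cong (_% n) (+-assoc (u % n) p q)) (%-+ˡ u (p + q)))
    shuffle : ∀ X A B T → X + A + (B + T) ≡ X + ((A + B) + T)
    shuffle = solve 4 (λ X A B T → X :+ A :+ (B :+ T) := X :+ ((A :+ B) :+ T)) refl
    shuffle′ : ∀ Y A B T → Y + B + (A + T) ≡ Y + ((A + B) + T)
    shuffle′ = solve 4 (λ Y A B T → Y :+ B :+ (A :+ T) := Y :+ ((A :+ B) :+ T)) refl

  Φ-odd : ∀ i X Y → X < n → Y < n → iterate (suc (2 * i)) Φ (X , Y) ≡ ((Y + B + i * k) % n , (X + A + i * k) % n)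
  Φ-odd i X Y X<n Y<n = trans (iterate-suc (2 * i) Φ (X , Y)) (trans (cong Φ (Φ-even i X Y X<n Y<n))
     (cong₂ _,_ (trans (%-+ˡ (Y + i * k) B) (cong (_% n) (shuffle Y B (i * k))))
                (trans (%-+ˡ (X + i * k) A) (cong (_% n) (shuffle X A (i * k))))))
    where
    shuffle : ∀ Y B T → Y + T + B ≡ Y + B + T
    shuffle = solve 3 (λ Y B T → Y :+ T :+ B := Y :+ B :+ T) refl

  φ-even : ∀ i x y → toℕ² (iterate (2 * i) φ (x , y)) ≡ ((toℕ x + i * k) % n , (toℕ y + i * k) % n)
  φ-even i x y = trans (iterate-intertwine φ Φ toℕ² toℕ²-φ (2 * i) (x , y))
                       (Φ-even i (toℕ x) (toℕ y) (Finₚ.toℕ<n x) (Finₚ.toℕ<n y))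

  φ-odd : ∀ i x y → toℕ² (iterate (suc (2 * i)) φ (x , y)) ≡ ((toℕ y + B + i * k) % n , (toℕ x + A + i * k) % n)
  φ-odd i x y = trans (iterate-intertwine φ Φ toℕ² toℕ²-φ (suc (2 * i)) (x , y))
                      (Φ-odd i (toℕ x) (toℕ y) (Finₚ.toℕ<n x) (Finₚ.toℕ<n y))

  odd-shift : ∀ i → B + i * k + (A + i * k) ≡ suc (2 * i) * k
  odd-shift i = identity A B i
    where
    identity : ∀ A B i → B + i * (A + B) + (A + i * (A + B)) ≡ suc (2 * i) * (A + B)
    identity = solve 3 (λ A B i → B :+ i :* (A :+ B) :+ (A :+ i :* (A :+ B)) := (con 1 :+ con 2 :* i) :* (A :+ B)) refl

  second-coordinate : ∀ i X Y → (Y + B + i * k) % n ≡ X → (X + A + i * k) % n ≡ (Y + suc (2 * i) * k) % n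
  second-coordinate i X Y h = begin
      (X + A + i * k) % n                       ≡⟨ cong (_% n) (+-assoc X A (i * k)) ⟩
      (X + (A + i * k)) % n                     ≡⟨ cong (λ z → (z + (A + i * k)) % n) h ⟨
      ((Y + B + i * k) % n + (A + i * k)) % n   ≡⟨ %-+ˡ (Y + B + i * k) (A + i * k) ⟩
      (Y + B + i * k + (A + i * k)) % n         ≡⟨ cong (λ z → (z + (A + i * k)) % n) (+-assoc Y B (i * k)) ⟩
      (Y + (B + i * k) + (A + i * k)) % n       ≡⟨ cong (_% n) (+-assoc Y (B + i * k) (A + i * k)) ⟩
      (Y + (B + i * k + (A + i * k))) % n       ≡⟨ cong (λ z → (Y + z) % n) (odd-shift i) ⟩
      (Y + suc (2 * i) * k) % n                 ∎
    where open ≡-Reasoning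

  iterate-2e : ∀ c → iterate (2 * e) φ c ≡ c
  iterate-2e (x , y) = toℕ²-injective _ _ (trans (φ-even e x y) (cong₂ _,_ (back x) (back y)))
    where
    back : ∀ z → (toℕ z + e * k) % n ≡ toℕ z
    back z = trans (%-remove-+ʳ (toℕ z) (n∣ord*k k)) (m<n⇒m%n≡m (Finₚ.toℕ<n z))

  even-fixed⇒∣ : ∀ i c → iterate (2 * i) φ c ≡ c → n ∣ i * k
  even-fixed⇒∣ i (x , y) h = +-%-fixed⇒∣ (toℕ x) (i * k) (Finₚ.toℕ<n x)
    (trans (sym (cong proj₁ (φ-even i x y))) (cong (toℕ ∘ proj₁) h))

  odd-fixed⇒∣ : ∀ i c → iterate (suc (2 * i)) φ c ≡ c → n ∣ suc (2 * i) * k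
  odd-fixed⇒∣ i (x , y) h = +-%-fixed⇒∣ (toℕ y) _ (Finₚ.toℕ<n y)
    (trans (sym (second-coordinate i (toℕ x) (toℕ y) first)) second)
    where
    first : (toℕ y + B + i * k) % n ≡ toℕ x
    first = trans (sym (cong proj₁ (φ-odd i x y))) (cong (toℕ ∘ proj₁) h)
    second : (toℕ x + A + i * k) % n ≡ toℕ y
    second = trans (sym (cong proj₂ (φ-odd i x y))) (cong (toℕ ∘ proj₂) h)

  odd-fixed⇒graph : ∀ i x y → iterate (suc (2 * i)) φ (x , y) ≡ (x , y) → x ≡ fromℕ< (m%n<n (toℕ y + B + i * k) n)
  odd-fixed⇒graph i x y h = Finₚ.toℕ-injective
    (trans (sym (cong (toℕ ∘ proj₁) h)) (trans (cong proj₁ (φ-odd i x y)) (sym (Finₚ.toℕ-fromℕ< _))))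

  graph⇒odd-fixed : ∀ i x y → n ∣ suc (2 * i) * k →
                    x ≡ fromℕ< (m%n<n (toℕ y + B + i * k) n) → iterate (suc (2 * i)) φ (x , y) ≡ (x , y)
  graph⇒odd-fixed i x y n∣ refl = toℕ²-injective _ _ (trans (φ-odd i x y) (cong₂ _,_ (sym first) second))
    where
    first : toℕ x ≡ (toℕ y + B + i * k) % n
    first = Finₚ.toℕ-fromℕ< _
    second : (toℕ x + A + i * k) % n ≡ toℕ y
    second = trans (second-coordinate i (toℕ x) (toℕ y) (sym first))
               (trans (%-remove-+ʳ (toℕ y) n∣) (m<n⇒m%n≡m (Finₚ.toℕ<n y)))

  e-pos : 0 < e
  e-pos = ord-pos k

  2e-pos : 0 < 2 * e
  2e-pos = ≤-trans e-pos (m≤m+n e (e + 0))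

  φ-injective : ∀ c d → φ c ≡ φ d → c ≡ d
  φ-injective c d h = begin
      c                          ≡⟨ iterate-2e c ⟨
      iterate (2 * e) φ c        ≡⟨ cong (λ j → iterate j φ c) 2e≡1+[2e∸1] ⟩
      iterate (2 * e ∸ 1) φ (φ c) ≡⟨ cong (iterate (2 * e ∸ 1) φ) h ⟩
      iterate (2 * e ∸ 1) φ (φ d) ≡⟨ cong (λ j → iterate j φ d) 2e≡1+[2e∸1] ⟨
      iterate (2 * e) φ d        ≡⟨ iterate-2e d ⟩
      d                          ∎
    where
    open ≡-Reasoning
    2e≡1+[2e∸1] : 2 * e ≡ suc (2 * e ∸ 1)
    2e≡1+[2e∸1] = sym (m+[n∸m]≡n 2e-pos)

  -- φ² translates by (k , k), so orbits have length 2e, or e when e is odd and φ^e fixes them.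
  isShort : Cell n → Bool
  isShort c = isOdd e ∧ does (iterate e φ c ≟ᶜ c)

  L : Cell n → ℕ
  L c = if isShort c then e else 2 * e

  L-pos : ∀ c → 0 < L c
  L-pos c with isShort c
  ... | true  = e-pos
  ... | false = 2e-pos

  iterate-L : ∀ c → iterate (L c) φ c ≡ c
  iterate-L c with isShort c in short
  ... | true  = does⇒ (iterate e φ c ≟ᶜ c) (proj₂ (∧-true {isOdd e} short))
  ... | false = iterate-2e c

  L≤2e : ∀ c → L c ≤ 2 * e
  L≤2e c with isShort c
  ... | true  = m≤m+n e (e + 0)
  ... | false = ≤-refl

  L-minimal : ∀ c j → 0 < j → j < L c → iterate j φ c ≢ c
  L-minimal c j 0<j j<L h with parity j
  ... | even i = <-irrefl refl (<-≤-trans (≤-trans j<L (L≤2e c)) (*-monoʳ-≤ 2 e≤i))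
    where
    i-pos : ∀ i → 0 < 2 * i → 0 < i
    i-pos (suc _) _ = s≤s z≤n
    e≤i : e ≤ i
    e≤i = ∣⇒≤ {{>-nonZero (i-pos i 0<j)}} (n∣j*k⇒ord∣j k i (even-fixed⇒∣ i c h))
  ... | odd i = <-irrefl (sym L≡j) j<L
    where
    j≡e : suc (2 * i) ≡ e
    j≡e with n∣j*k⇒ord∣j k (suc (2 * i)) (odd-fixed⇒∣ i c h) | ≤-trans j<L (L≤2e c)
    ... | divides (suc zero)    eq | _   = trans eq (+-identityʳ e)
    ... | divides (suc (suc q)) eq | j<2e = ⊥-elim (<-irrefl eq (<-≤-trans j<2e (+-monoʳ-≤ e (+-monoʳ-≤ e z≤n))))
    short : isShort c ≡ true
    short = cong₂ _∧_ (trans (cong isOdd (sym j≡e)) (isOdd-odd i))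
                      (dec-true (iterate e φ c ≟ᶜ c) (trans (cong (λ z → iterate z φ c) (sym j≡e)) h))
    L≡j : L c ≡ suc (2 * i)
    L≡j = trans (cong (λ s → if s then e else 2 * e) short) (sym j≡e)

  isShort-φ : ∀ c → isShort (φ c) ≡ isShort c
  isShort-φ c = cong (isOdd e ∧_) (does-⇔
    (mk⇔ (λ h → φ-injective _ _ (trans (sym (iterate-suc e φ c)) h)) (λ h → trans (iterate-suc e φ c) (cong φ h)))
    (iterate e φ (φ c) ≟ᶜ φ c) (iterate e φ c ≟ᶜ c))

  L-φ : ∀ c → L (φ c) ≡ L c
  L-φ c = cong (λ s → if s then e else 2 * e) (isShort-φ c)

  open CellOrbits φ L L-pos iterate-L L-minimal L-φ public

  count-short-even : isOdd e ≡ false → count isShort (cells n) ≡ 0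
  count-short-even e-even =
    trans (sumL-cong (cells n) (λ c → cong (λ s → ind (s ∧ does (iterate e φ c ≟ᶜ c))) e-even)) (sumL-zero (cells n))

  count-short-odd : isOdd e ≡ true → count isShort (cells n) ≡ n
  count-short-odd e-odd with odd-view e e-odd
  ... | i , e≡ = begin
      count isShort (cells n)
    ≡⟨ sumL-cells n _ ⟩
      sumL (allFin n) (λ x → sumL (allFin n) (λ y → ind (isShort (x , y))))
    ≡⟨ sumL-cong (allFin n) (λ x → sumL-cong (allFin n) (λ y → cong ind (short⇔graph x y))) ⟩
      sumL (allFin n) (λ x → sumL (allFin n) (λ y → ind (does (x ≟ᶠ partner y))))
    ≡⟨ sumL-comm (allFin n) (allFin n) _ ⟩
      sumL (allFin n) (λ y → count (λ x → does (x ≟ᶠ partner y)) (allFin n))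
    ≡⟨ sumL-cong (allFin n) (λ y → allFin-once n (partner y)) ⟩
      sumL (allFin n) (λ _ → 1)
    ≡⟨ trans (sumL-allFin n _) (trans (sumF-const n 1) (*-identityʳ n)) ⟩
      n ∎
    where
    open ≡-Reasoning
    partner : Fin n → Fin n
    partner y = fromℕ< (m%n<n (toℕ y + B + i * k) n)
    n∣ : n ∣ suc (2 * i) * k
    n∣ = subst (λ z → n ∣ z * k) e≡ (n∣ord*k k)
    short⇔graph : ∀ x y → isShort (x , y) ≡ does (x ≟ᶠ partner y)
    short⇔graph x y = trans (cong (_∧ does (iterate e φ (x , y) ≟ᶜ (x , y))) e-odd)
      (does-⇔
        (mk⇔ (λ h → odd-fixed⇒graph i x y (subst (λ z → iterate z φ (x , y) ≡ (x , y)) e≡ h))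
             (λ h → subst (λ z → iterate z φ (x , y) ≡ (x , y)) (sym e≡) (graph⇒odd-fixed i x y n∣ h)))
        (iterate e φ (x , y) ≟ᶜ (x , y)) (x ≟ᶠ partner y))

fixFormula : ℕ → ℕ → ℕ → ℕ → ℕ
fixFormula n M t d = if isOdd d then M ^ ((n * n ∸ n) div (2 * d)) * t ^ (n div d) else M ^ ((n * n) div (2 * d))

*-div : ∀ x d → 0 < d → (x * d) div d ≡ x
*-div x (suc d) _ = m*n/n≡m x (suc d)

module RfCount (n : ℕ) .{{_ : NonZero n}} (a b : Fin n) {m₀ : ℕ} (ψ : Fin (suc m₀) → Fin (suc m₀))
  (ψ-involutive : ∀ t → ψ (ψ t) ≡ t) where

  open RfShift n a b
  open EquivariantCount ψ

  fixedTiles : ℕ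
  fixedTiles = count (λ t → does (ψ t ≟ᶠ t)) (allFin m)

  shortReps longReps : ℕ
  shortReps = sumL (cells n) (λ c → ind (isShort c ∧ isRep c))
  longReps  = sumL (cells n) (λ c → ind (not (isShort c) ∧ isRep c))

  -- ψ is an involution: ψ^e = ψ for odd e, and ψ^(2e) = id.
  slot-count : ∀ c → choices c ≡ fixedTiles ^ ind (isShort c ∧ isRep c) * m ^ ind (not (isShort c) ∧ isRep c)
  slot-count c = cases (isRep c) (isShort c) (λ h → proj₁ (∧-true {isOdd e} h))
    where
    cases : ∀ r s → (s ≡ true → isOdd e ≡ true) →
            (if r then count (λ t → does (iterate (if s then e else 2 * e) ψ t ≟ᶠ t)) (allFin m) else 1)
            ≡ fixedTiles ^ ind (s ∧ r) * m ^ ind (not s ∧ r)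
    cases false false _ = refl
    cases false true  _ = refl
    cases true  false _ = trans (count-allFin-true m _ (λ t → dec-true (_ ≟ᶠ t) (iterate-involution-even ψ ψ-involutive e t)))
                            (sym (trans (*-identityˡ (m * 1)) (*-identityʳ m)))
    cases true  true  short with odd-view e (short refl)
    ... | i , e≡ = trans (sumL-cong (allFin m) (λ t → cong (λ u → ind (does (u ≟ᶠ t)))
                           (trans (cong (λ j → iterate j ψ t) e≡) (iterate-involution-odd ψ ψ-involutive i t))))
                         (sym (trans (*-identityʳ (fixedTiles * 1)) (*-identityʳ fixedTiles)))

  count-rf : count (equivariantᵇ φ ψ) (allTilings n m) ≡ fixedTiles ^ shortReps * m ^ longReps
  count-rf = begin
      count (equivariantᵇ φ ψ) (allTilings n m)
    ≡⟨ count-equivariant ⟩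
      prodF n (λ x → prodF n (λ y → choices (x , y)))
    ≡⟨ prodF-cong n (λ x → trans (prodF-cong n (λ y → slot-count (x , y))) (prodF-^-* n fixedTiles m _ _)) ⟩
      prodF n (λ x → fixedTiles ^ sumF n (λ y → ind (isShort (x , y) ∧ isRep (x , y)))
                     * m ^ sumF n (λ y → ind (not (isShort (x , y)) ∧ isRep (x , y))))
    ≡⟨ prodF-^-* n fixedTiles m _ _ ⟩
      fixedTiles ^ sumF n (λ x → sumF n (λ y → ind (isShort (x , y) ∧ isRep (x , y))))
        * m ^ sumF n (λ x → sumF n (λ y → ind (not (isShort (x , y)) ∧ isRep (x , y))))
    ≡⟨ cong₂ (λ p q → fixedTiles ^ p * m ^ q) (sumL-cells≡sumF n _) (sumL-cells≡sumF n _) ⟨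
      fixedTiles ^ shortReps * m ^ longReps ∎
    where open ≡-Reasoning

  shortReps*e : shortReps * e ≡ count isShort (cells n)
  shortReps*e = trans (sym (sumL-*ʳ (cells n) e _)) (trans (sumL-cong (cells n) weight) (count-by-orbits isShort isShort-φ))
    where
    weight : ∀ c → ind (isShort c ∧ isRep c) * e ≡ ind (isShort c ∧ isRep c) * L c
    weight c with isShort c
    ... | true  = refl
    ... | false = refl

  longReps*2e : longReps * (2 * e) ≡ count (not ∘ isShort) (cells n)
  longReps*2e = trans (sym (sumL-*ʳ (cells n) (2 * e) _))
    (trans (sumL-cong (cells n) weight) (count-by-orbits (not ∘ isShort) (λ c → cong not (isShort-φ c))))
    where
    weight : ∀ c → ind (not (isShort c) ∧ isRep c) * (2 * e) ≡ ind (not (isShort c) ∧ isRep c) * L c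
    weight c with isShort c
    ... | true  = refl
    ... | false = refl

  long-count : count (not ∘ isShort) (cells n) ≡ n * n ∸ count isShort (cells n)
  long-count = trans (sym (m+n∸m≡n (count isShort (cells n)) _)) (cong (_∸ count isShort (cells n)) short+long)
    where
    short+long : count isShort (cells n) + count (not ∘ isShort) (cells n) ≡ n * n
    short+long = trans (sym (sumL-+ (cells n) _ _))
      (trans (sumL-cong (cells n) (λ c → ind-not (isShort c))) (trans (sumL-cells-const n 1) (cong (n *_) (*-identityʳ n))))

  count-rf-formula : count (equivariantᵇ φ ψ) (allTilings n m) ≡ fixFormula n m fixedTiles e
  count-rf-formula = by-parity (isOdd e) refl
    where
    open ≡-Reasoning

    by-parity : ∀ s → isOdd e ≡ s →
      count (equivariantᵇ φ ψ) (allTilings n m) ≡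
      (if s then m ^ ((n * n ∸ n) div (2 * e)) * fixedTiles ^ (n div e) else m ^ ((n * n) div (2 * e)))
    by-parity true e-odd = begin
        count (equivariantᵇ φ ψ) (allTilings n m)             ≡⟨ count-rf ⟩
        fixedTiles ^ shortReps * m ^ longReps                 ≡⟨ *-comm (fixedTiles ^ shortReps) _ ⟩
        m ^ longReps * fixedTiles ^ shortReps                 ≡⟨ cong₂ (λ p q → m ^ p * fixedTiles ^ q) long short ⟨
        m ^ ((n * n ∸ n) div (2 * e)) * fixedTiles ^ (n div e) ∎
      where
      short-count : count isShort (cells n) ≡ n
      short-count = count-short-odd e-odd
      short : n div e ≡ shortReps
      short = trans (cong (_div e) (sym (trans shortReps*e short-count))) (*-div shortReps e e-pos)
      long : (n * n ∸ n) div (2 * e) ≡ longReps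
      long = trans (cong (_div (2 * e)) (sym (trans longReps*2e (trans long-count (cong (n * n ∸_) short-count)))))
               (*-div longReps (2 * e) 2e-pos)
    by-parity false e-even = begin
        count (equivariantᵇ φ ψ) (allTilings n m)  ≡⟨ count-rf ⟩
        fixedTiles ^ shortReps * m ^ longReps      ≡⟨ cong₂ (λ p q → fixedTiles ^ p * m ^ q) no-short long ⟨
        1 * m ^ ((n * n) div (2 * e))              ≡⟨ *-identityˡ _ ⟩
        m ^ ((n * n) div (2 * e))                  ∎
      where
      short-count : count isShort (cells n) ≡ 0
      short-count = count-short-even e-even
      no-short : 0 ≡ shortReps
      no-short with m*n≡0⇒m≡0∨n≡0 shortReps (trans shortReps*e short-count)
      ... | inj₁ none = sym none
      ... | inj₂ e≡0  = ⊥-elim (<-irrefl (sym e≡0) e-pos)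
      long : (n * n) div (2 * e) ≡ longReps
      long = trans (cong (_div (2 * e)) (sym (trans longReps*2e (trans long-count (cong (n * n ∸_) short-count)))))
               (*-div longReps (2 * e) 2e-pos)

fixFormula-empty : ∀ n d → 0 < d → d ≤ n → fixFormula n 0 0 d ≡ 0
fixFormula-empty n d d-pos d≤n = by-parity (isOdd d) refl
  where
  0^ : ∀ j → 0 < j → 0 ^ j ≡ 0
  0^ (suc j) _ = refl
  div-pos : ∀ x d → 0 < d → d ≤ x → 0 < x div d
  div-pos x (suc d) _ le = m≥n⇒m/n>0 le
  by-parity : ∀ s → isOdd d ≡ s →
    (if s then 0 ^ ((n * n ∸ n) div (2 * d)) * 0 ^ (n div d) else 0 ^ ((n * n) div (2 * d))) ≡ 0
  by-parity true  _      = trans (cong (0 ^ ((n * n ∸ n) div (2 * d)) *_) (0^ _ (div-pos n d d-pos d≤n)))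
                                 (*-zeroʳ (0 ^ ((n * n ∸ n) div (2 * d))))
  by-parity false d-even = 0^ _ (div-pos (n * n) (2 * d) (≤-trans d-pos (m≤m+n d (d + 0))) 2d≤n*n)
    where
    even⇒2≤ : ∀ d → 0 < d → isOdd d ≡ false → 2 ≤ d
    even⇒2≤ (suc (suc _)) _ _ = s≤s (s≤s z≤n)
    2≤d : 2 ≤ d
    2≤d = even⇒2≤ d d-pos d-even
    2d≤n*n : 2 * d ≤ n * n
    2d≤n*n = ≤-trans (*-monoʳ-≤ 2 d≤n) (*-monoˡ-≤ n (≤-trans 2≤d d≤n))

module _ (n : ℕ) .{{_ : NonZero n}} where
  open ModArith n

  count-rf-equivariant : (a b : Fin n) (m : ℕ) (ψ : Fin m → Fin m) → (∀ t → ψ (ψ t) ≡ t) →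
    count (equivariantᵇ (RfShift.φ n a b) ψ) (allTilings n m)
      ≡ fixFormula n m (count (λ t → does (ψ t ≟ᶠ t)) (allFin m)) (ord (toℕ a + toℕ b))
  count-rf-equivariant a b zero    ψ _  = trans (cong (count _) (allTilings-empty n))
    (sym (fixFormula-empty n _ (ord-pos (toℕ a + toℕ b)) (∣⇒≤ (ord∣n (toℕ a + toℕ b)))))
  count-rf-equivariant a b (suc _) ψ ψψ = RfCount.count-rf-formula n a b ψ ψψ

module FinArith (n : ℕ) .{{_ : NonZero n}} where
  open ModArith n

  toℕ-+ₙ : ∀ (u v : Fin n) → toℕ (u +ₙ v) ≡ (toℕ u + toℕ v) % n
  toℕ-+ₙ u v = Finₚ.toℕ-fromℕ< _

  neg : Fin n → Fin n
  neg b = fromℕ< (m%n<n (n ∸ toℕ b) n)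

  _-ₙ_ : Fin n → Fin n → Fin n
  j -ₙ a = fromℕ< (m%n<n (toℕ j + (n ∸ toℕ a)) n)

  %-injective : ∀ {u v} t → u < n → v < n → (u + t) % n ≡ (v + t) % n → u ≡ v
  %-injective {u} {v} t u<n v<n h = trans (sym (m<n⇒m%n≡m u<n)) (trans (+-cancelʳ-% u v t h) (m<n⇒m%n≡m v<n))

  private
    a+[b+[n∸a]]≡b+n : ∀ a b → a ≤ n → a + (b + (n ∸ a)) ≡ b + n
    a+[b+[n∸a]]≡b+n a b a≤n = trans (sym (+-assoc a b _)) (trans (cong (_+ (n ∸ a)) (+-comm a b))
      (trans (+-assoc b a _) (cong (b +_) (m+[n∸m]≡n a≤n))))

    reduce : ∀ (b : Fin n) → (toℕ b + n) % n ≡ toℕ b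
    reduce b = trans ([m+n]%n≡m%n (toℕ b) n) (m<n⇒m%n≡m (Finₚ.toℕ<n b))

  [a+b]-a≡b : ∀ a b → (a +ₙ b) -ₙ a ≡ b
  [a+b]-a≡b a b = Finₚ.toℕ-injective (begin
      toℕ ((a +ₙ b) -ₙ a)                       ≡⟨ Finₚ.toℕ-fromℕ< _ ⟩
      (toℕ (a +ₙ b) + (n ∸ toℕ a)) % n          ≡⟨ cong (λ z → (z + (n ∸ toℕ a)) % n) (toℕ-+ₙ a b) ⟩
      ((toℕ a + toℕ b) % n + (n ∸ toℕ a)) % n   ≡⟨ %-+ˡ (toℕ a + toℕ b) _ ⟩
      (toℕ a + toℕ b + (n ∸ toℕ a)) % n         ≡⟨ cong (_% n) (+-assoc (toℕ a) (toℕ b) _) ⟩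
      (toℕ a + (toℕ b + (n ∸ toℕ a))) % n       ≡⟨ cong (_% n) (a+[b+[n∸a]]≡b+n (toℕ a) (toℕ b) (<⇒≤ (Finₚ.toℕ<n a))) ⟩
      (toℕ b + n) % n                           ≡⟨ reduce b ⟩
      toℕ b                                     ∎)
    where open ≡-Reasoning

  a+[j-a]≡j : ∀ a j → a +ₙ (j -ₙ a) ≡ j
  a+[j-a]≡j a j = Finₚ.toℕ-injective (begin
      toℕ (a +ₙ (j -ₙ a))                       ≡⟨ toℕ-+ₙ a (j -ₙ a) ⟩
      (toℕ a + toℕ (j -ₙ a)) % n                ≡⟨ cong (λ z → (toℕ a + z) % n) (Finₚ.toℕ-fromℕ< _) ⟩
      (toℕ a + (toℕ j + (n ∸ toℕ a)) % n) % n   ≡⟨ %-+ʳ (toℕ a) _ ⟩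
      (toℕ a + (toℕ j + (n ∸ toℕ a))) % n       ≡⟨ cong (_% n) (a+[b+[n∸a]]≡b+n (toℕ a) (toℕ j) (<⇒≤ (Finₚ.toℕ<n a))) ⟩
      (toℕ j + n) % n                           ≡⟨ reduce j ⟩
      toℕ j                                     ∎)
    where open ≡-Reasoning

  neg-involutive : ∀ b → neg (neg b) ≡ b
  neg-involutive b = Finₚ.toℕ-injective (trans (Finₚ.toℕ-fromℕ< _)
    (trans (cong (λ z → (n ∸ z) % n) (Finₚ.toℕ-fromℕ< (m%n<n (n ∸ toℕ b) n))) (go (toℕ b) (Finₚ.toℕ<n b))))
    where
    go : ∀ B → B < n → (n ∸ (n ∸ B) % n) % n ≡ B
    go zero    _   = trans (cong (λ z → (n ∸ z) % n) (n%n≡0 n)) (n%n≡0 n)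
    go (suc B) B<n = trans (cong (λ z → (n ∸ z) % n) (m<n⇒m%n≡m (∸-monoʳ-< {n} {suc B} {0} (s≤s z≤n) (<⇒≤ B<n))))
                       (trans (cong (_% n) (m∸[m∸n]≡n (<⇒≤ B<n))) (m<n⇒m%n≡m B<n))

  opposite-unique : ∀ (w z : Fin n) → (toℕ w + suc (toℕ z)) % n ≡ 0 → w ≡ opposite z
  opposite-unique w z h = Finₚ.toℕ-injective (%-injective (suc (toℕ z)) (Finₚ.toℕ<n w) (Finₚ.toℕ<n (opposite z))
    (trans h (sym (trans (cong (λ u → (u + suc (toℕ z)) % n) (Finₚ.opposite-prop z))
      (trans (cong (_% n) (m∸n+n≡m (Finₚ.toℕ<n z))) (n%n≡0 n))))))

  opposite-+ₙ : ∀ (y b : Fin n) → opposite (opposite y +ₙ b) ≡ y +ₙ neg b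
  opposite-+ₙ y b = sym (opposite-unique (y +ₙ neg b) (opposite y +ₙ b) (begin
      (toℕ (y +ₙ neg b) + suc (toℕ (opposite y +ₙ b))) % n
        ≡⟨ cong₂ (λ u v → (u + suc v) % n) (trans (toℕ-+ₙ y (neg b)) (cong (λ z → (Y′ + z) % n) (Finₚ.toℕ-fromℕ< _)))
                                           (trans (toℕ-+ₙ (opposite y) b) (cong (λ z → (z + B) % n) (Finₚ.opposite-prop y))) ⟩
      ((Y′ + N) % n + suc V) % n                ≡⟨ %-+ˡ (Y′ + N) (suc V) ⟩
      (Y′ + N + suc V) % n                      ≡⟨ cong (λ z → (Y′ + N + z) % n) (+-comm 1 V) ⟩
      (Y′ + N + (V + 1)) % n                    ≡⟨ %-+ʳ (Y′ + N) (V + 1) ⟨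
      (Y′ + N + (V + 1) % n) % n                ≡⟨ cong (λ z → (Y′ + N + z) % n) (%-+ˡ (n ∸ suc Y′ + B) 1) ⟩
      (Y′ + N + (n ∸ suc Y′ + B + 1) % n) % n    ≡⟨ %-+ʳ (Y′ + N) _ ⟩
      (Y′ + N + (n ∸ suc Y′ + B + 1)) % n        ≡⟨ cong (_% n) (shuffle Y′ (n ∸ suc Y′) N B) ⟩
      (Y′ + (n ∸ suc Y′) + 1 + (N + B)) % n      ≡⟨ cong (λ z → (z + (N + B)) % n) Y′+[n∸1+Y′]+1≡n ⟩
      (n + (N + B)) % n                        ≡⟨ cong (_% n) (+-comm n (N + B)) ⟩
      (N + B + n) % n                          ≡⟨ [m+n]%n≡m%n (N + B) n ⟩
      (N + B) % n                              ≡⟨ %-+ˡ (n ∸ B) B ⟩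
      (n ∸ B + B) % n                          ≡⟨ cong (_% n) (m∸n+n≡m (<⇒≤ (Finₚ.toℕ<n b))) ⟩
      n % n                                    ≡⟨ n%n≡0 n ⟩
      0                                        ∎))
    where
    open ≡-Reasoning
    Y′ B N V : ℕ
    Y′ = toℕ y
    B = toℕ b
    N = (n ∸ B) % n
    V = (n ∸ suc Y′ + B) % n
    Y′+[n∸1+Y′]+1≡n : Y′ + (n ∸ suc Y′) + 1 ≡ n
    Y′+[n∸1+Y′]+1≡n = trans (+-comm (Y′ + (n ∸ suc Y′)) 1) (m+[n∸m]≡n (Finₚ.toℕ<n y))
    shuffle : ∀ Y′ M N B → Y′ + N + (M + B + 1) ≡ (Y′ + M + 1) + (N + B)
    shuffle = solve 4 (λ Y′ M N B → Y′ :+ N :+ (M :+ B :+ con 1) := (Y′ :+ M :+ con 1) :+ (N :+ B)) refl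

count-equivariant-conjugate : ∀ {n m} (φ φ′ κ : Cell n → Cell n) (ψ : Fin m → Fin m) →
  (∀ c → κ (κ c) ≡ c) → (∀ c → φ (κ c) ≡ κ (φ′ c)) →
  count (equivariantᵇ φ ψ) (allTilings n m) ≡ count (equivariantᵇ φ′ ψ) (allTilings n m)
count-equivariant-conjugate {n} {m} φ φ′ κ ψ κ-involutive φκ≡κφ′ =
  count-bijection _≟ᵗ_ _≟ᵗ_ (allTilings n m) (allTilings n m) (equivariantᵇ φ ψ) (equivariantᵇ φ′ ψ) pull pull
    (λ τ _ → allTilings-once n m τ) (λ τ _ → allTilings-once n m τ)
    (λ τ eq → equivariantᵇ-complete φ′ ψ (pull τ) (transport φ φ′ φκ≡κφ′ τ (equivariantᵇ-sound φ ψ τ eq)))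
    (λ τ eq → equivariantᵇ-complete φ ψ (pull τ) (transport φ′ φ φ′κ≡κφ τ (equivariantᵇ-sound φ′ ψ τ eq)))
    (λ τ _ → pull-involutive τ) (λ τ _ → pull-involutive τ)
  where
  pull : Tiling n m → Tiling n m
  pull τ = tabulateTiling (tileAt τ ∘ κ)

  pull-involutive : ∀ τ → pull (pull τ) ≡ τ
  pull-involutive τ = tiling-ext λ c →
    trans (tileAt-tabulate _ c) (trans (tileAt-tabulate _ (κ c)) (cong (tileAt τ) (κ-involutive c)))

  φ′κ≡κφ : ∀ c → φ′ (κ c) ≡ κ (φ c)
  φ′κ≡κφ c = sym (trans (cong (κ ∘ φ) (sym (κ-involutive c))) (trans (cong κ (φκ≡κφ′ (κ c))) (κ-involutive (φ′ (κ c)))))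

  transport : ∀ φ₁ φ₂ → (∀ c → φ₁ (κ c) ≡ κ (φ₂ c)) → ∀ τ → Equivariant φ₁ ψ τ → Equivariant φ₂ ψ (pull τ)
  transport φ₁ φ₂ comm τ eq c = begin
      tileAt (pull τ) (φ₂ c)   ≡⟨ tileAt-tabulate _ (φ₂ c) ⟩
      tileAt τ (κ (φ₂ c))      ≡⟨ cong (tileAt τ) (comm c) ⟨
      tileAt τ (φ₁ (κ c))      ≡⟨ eq (κ c) ⟩
      ψ (tileAt τ (κ c))       ≡⟨ cong ψ (tileAt-tabulate _ c) ⟨
      ψ (tileAt (pull τ) c)    ∎
    where open ≡-Reasoning

module _ (n : ℕ) .{{_ : NonZero n}} where
  open FinArith n

  reflectʸ : Cell n → Cell n
  reflectʸ (x , y) = x , opposite y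

  r3f-conjugate : ∀ a b c → affAct (reflectʸ c) (a , b) r3f ≡ reflectʸ (RfShift.φ n a (neg b) c)
  r3f-conjugate a b (x , y) = cong (_, opposite (x +ₙ a))
    (trans (Finₚ.opposite-involutive (opposite (opposite y +ₙ b)))
      (trans (opposite-+ₙ y b) (sym (Finₚ.opposite-involutive (y +ₙ neg b)))))

  count-r3f-equivariant : (a b : Fin n) (m : ℕ) (ψ : Fin m → Fin m) → (∀ t → ψ (ψ t) ≡ t) →
    count (equivariantᵇ (λ c → affAct c (a , b) r3f) ψ) (allTilings n m)
      ≡ fixFormula n m (count (λ t → does (ψ t ≟ᶠ t)) (allFin m)) (ModArith.ord n (toℕ a + toℕ (neg b)))
  count-r3f-equivariant a b m ψ ψψ =
    trans (count-equivariant-conjugate _ (RfShift.φ n a (neg b)) reflectʸ ψ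
             (λ (x , y) → cong (x ,_) (Finₚ.opposite-involutive y)) (r3f-conjugate a b))
          (count-rf-equivariant n a (neg b) m ψ ψψ)

in[1,_] : ℕ → ℕ → Bool
in[1, n ] k = (0 <ᵇ k) ∧ (k <ᵇ suc n)

in[1,]-sound : ∀ n k → in[1, n ] k ≡ true → (0 < k) × (k ≤ n)
in[1,]-sound n k h with ∧-true {0 <ᵇ k} h
... | 0<k , k≤n = <ᵇ⇒< 0 k (≡true⇒T 0<k) , ≤-pred (<ᵇ⇒< k (suc n) (≡true⇒T k≤n))

in[1,]-complete : ∀ n k → 0 < k → k ≤ n → in[1, n ] k ≡ true
in[1,]-complete n k 0<k k≤n = cong₂ _∧_ (T⇒≡true (<⇒<ᵇ 0<k)) (T⇒≡true (<⇒<ᵇ (s≤s k≤n)))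

in[1,]-once : ∀ n k → in[1, n ] k ≡ true → OccursOnce _≟ℕ_ (map suc (range n)) k
in[1,]-once n k h = suc-range-once n k (proj₁ (in[1,]-sound n k h)) (proj₂ (in[1,]-sound n k h))

count-∧-in[1,] : ∀ n (P : ℕ → Bool) → count (λ k → P k ∧ in[1, n ] k) (map suc (range n)) ≡ count P (map suc (range n))
count-∧-in[1,] n P = trans (sumL-map suc (range n) _) (trans (sumL-range-cong n in-range) (sym (sumL-map suc (range n) _)))
  where
  in-range : ∀ i → i < n → ind (P (suc i) ∧ in[1, n ] (suc i)) ≡ ind (P (suc i))
  in-range i i<n = cong ind (trans (cong (P (suc i) ∧_) (in[1,]-complete n (suc i) (s≤s z≤n) i<n)) (∧-identityʳ _))

module OrderCount (n : ℕ) .{{_ : NonZero n}} where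
  open ModArith n

  -- If n = d c then ord k = d exactly when gcd k n = c, and k ↦ k / c maps these
  -- k ∈ [1, n] bijectively onto the j ∈ [1, d] coprime to d.
  module _ (d c : ℕ) (d*c≡n : d * c ≡ n) where

    private
      factors-pos : ∀ d c → d * c ≡ n → 0 < d × 0 < c
      factors-pos (suc _) (suc _) _   = s≤s z≤n , s≤s z≤n
      factors-pos zero    _       0≡n = ⊥-elim (<-irrefl 0≡n (>-nonZero⁻¹ n))
      factors-pos (suc d) zero    eq  = ⊥-elim (<-irrefl (trans (sym (*-zeroʳ (suc d))) eq) (>-nonZero⁻¹ n))
      d-pos : 0 < d
      d-pos = proj₁ (factors-pos d c d*c≡n)
      c-pos : 0 < c
      c-pos = proj₂ (factors-pos d c d*c≡n)
      instance
        c-nonZero : NonZero c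
        c-nonZero = >-nonZero c-pos

    ord≡d⇒gcd≡c : ∀ k → ord k ≡ d → gcd k n ≡ c
    ord≡d⇒gcd≡c k h = *-cancelˡ-≡ (gcd k n) c d {{>-nonZero d-pos}} (trans (cong (_* gcd k n) (sym h)) (trans (ord*gcd≡n k) (sym d*c≡n)))

    gcd≡c⇒ord≡d : ∀ k → gcd k n ≡ c → ord k ≡ d
    gcd≡c⇒ord≡d k h = *-cancelʳ-≡ (ord k) d c (trans (cong (ord k *_) (sym h)) (trans (ord*gcd≡n k) (sym d*c≡n)))

    hasOrder coprimeInRange : ℕ → Bool
    hasOrder k       = does (ord k ≟ℕ d) ∧ in[1, n ] k
    coprimeInRange j = does (gcd j d ≟ℕ 1) ∧ in[1, d ] j

    c∣k : ∀ k → hasOrder k ≡ true → c ∣ k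
    c∣k k h = subst (_∣ k) (ord≡d⇒gcd≡c k (does⇒ (_ ≟ℕ d) (proj₁ (∧-true h)))) (gcd[m,n]∣m k n)

    hasOrder⇒coprime : ∀ k → hasOrder k ≡ true → coprimeInRange (k / c) ≡ true
    hasOrder⇒coprime k h = cong₂ _∧_ (dec-true (gcd (k / c) d ≟ℕ 1) gcd≡1) (in[1,]-complete d (k / c) q-pos q≤d)
      where
      k∈ : (0 < k) × (k ≤ n)
      k∈ = in[1,]-sound n k (proj₂ (∧-true {does (ord k ≟ℕ d)} h))
      q*c≡k : k / c * c ≡ k
      q*c≡k = m/n*n≡m (c∣k k h)
      gcd≡1 : gcd (k / c) d ≡ 1
      gcd≡1 = *-cancelˡ-≡ (gcd (k / c) d) 1 c (begin
          c * gcd (k / c) d         ≡⟨ c*gcd[m,n]≡gcd[cm,cn] c (k / c) d ⟩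
          gcd (c * (k / c)) (c * d) ≡⟨ cong₂ gcd (trans (*-comm c _) q*c≡k) (trans (*-comm c d) d*c≡n) ⟩
          gcd k n                   ≡⟨ ord≡d⇒gcd≡c k (does⇒ (_ ≟ℕ d) (proj₁ (∧-true h))) ⟩
          c                         ≡⟨ *-identityʳ c ⟨
          c * 1                     ∎)
        where open ≡-Reasoning
      q-pos : 0 < k / c
      q-pos = m≥n⇒m/n>0 (∣⇒≤ {{>-nonZero (proj₁ k∈)}} (c∣k k h))
      q≤d : k / c ≤ d
      q≤d = *-cancelʳ-≤ (k / c) d c (subst₂ _≤_ (sym q*c≡k) (sym d*c≡n) (proj₂ k∈))

    coprime⇒hasOrder : ∀ j → coprimeInRange j ≡ true → hasOrder (j * c) ≡ true
    coprime⇒hasOrder j h = cong₂ _∧_ (dec-true (ord (j * c) ≟ℕ d) (gcd≡c⇒ord≡d (j * c) gcd≡c))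
      (in[1,]-complete n (j * c) (*-monoˡ-< c (proj₁ j∈)) (subst (j * c ≤_) d*c≡n (*-monoˡ-≤ c (proj₂ j∈))))
      where
      j∈ : (0 < j) × (j ≤ d)
      j∈ = in[1,]-sound d j (proj₂ (∧-true {does (gcd j d ≟ℕ 1)} h))
      gcd≡c : gcd (j * c) n ≡ c
      gcd≡c = begin
        gcd (j * c) n             ≡⟨ cong₂ gcd (*-comm j c) (trans (sym d*c≡n) (*-comm d c)) ⟩
        gcd (c * j) (c * d)       ≡⟨ c*gcd[m,n]≡gcd[cm,cn] c j d ⟨
        c * gcd j d               ≡⟨ cong (c *_) (does⇒ (_ ≟ℕ 1) (proj₁ (∧-true h))) ⟩
        c * 1                     ≡⟨ *-identityʳ c ⟩
        c                         ∎
        where open ≡-Reasoning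

    count-order≡totient : count (λ k → does (ord k ≟ℕ d)) (map suc (upTo n)) ≡ totient d
    count-order≡totient = begin
        count (λ k → does (ord k ≟ℕ d)) (map suc (upTo n))
      ≡⟨ cong (λ l → count (λ k → does (ord k ≟ℕ d)) (map suc l)) (upTo≡range n) ⟩
        count (λ k → does (ord k ≟ℕ d)) (map suc (range n))
      ≡⟨ count-∧-in[1,] n (λ k → does (ord k ≟ℕ d)) ⟨
        count hasOrder (map suc (range n))
      ≡⟨ count-bijection _≟ℕ_ _≟ℕ_ (map suc (range n)) (map suc (range d)) hasOrder coprimeInRange (_/ c) (_* c)
           (λ k h → in[1,]-once n k (proj₂ (∧-true {does (ord k ≟ℕ d)} h)))
           (λ j h → in[1,]-once d j (proj₂ (∧-true {does (gcd j d ≟ℕ 1)} h)))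
           hasOrder⇒coprime coprime⇒hasOrder (λ k h → m/n*n≡m (c∣k k h)) (λ j _ → m*n/n≡m j c) ⟩
        count coprimeInRange (map suc (range d))
      ≡⟨ count-∧-in[1,] d (λ j → does (gcd j d ≟ℕ 1)) ⟩
        count (λ j → does (gcd j d ≟ℕ 1)) (map suc (range d))
      ≡⟨ cong (λ l → count (λ j → does (gcd j d ≟ℕ 1)) (map suc l)) (upTo≡range d) ⟨
        count (λ j → does (gcd j d ≟ℕ 1)) (map suc (upTo d))
      ≡⟨ length∘filter≡count (λ j → gcd j d ≟ℕ 1) (map suc (upTo d)) ⟨
        totient d ∎
      where open ≡-Reasoning

  private
    K D : List ℕ
    K = map suc (upTo n)
    D = filter (_∣? n) K

    divisors-once : ∀ x → 0 < x → x ∣ n → OccursOnce _≟ℕ_ D x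
    divisors-once x 0<x x∣n = begin
        count (λ z → does (z ≟ℕ x)) D
      ≡⟨ sumL-filter (_∣? n) K _ ⟩
        sumL K (λ z → ind (does (z ∣? n)) * ind (does (z ≟ℕ x)))
      ≡⟨ sumL-cong K only-x ⟩
        count (λ z → does (z ≟ℕ x)) K
      ≡⟨ cong (λ l → count (λ z → does (z ≟ℕ x)) (map suc l)) (upTo≡range n) ⟩
        count (λ z → does (z ≟ℕ x)) (map suc (range n))
      ≡⟨ suc-range-once n x 0<x (∣⇒≤ x∣n) ⟩
        1 ∎
      where
      open ≡-Reasoning
      only-x : ∀ z → ind (does (z ∣? n)) * ind (does (z ≟ℕ x)) ≡ ind (does (z ≟ℕ x))
      only-x z with z ≟ℕ x
      ... | no z≢x   = trans (cong (λ b → ind (does (z ∣? n)) * ind b) not-x)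
                         (trans (*-zeroʳ (ind (does (z ∣? n)))) (sym (cong ind not-x)))
        where
        not-x : does (z ≟ℕ x) ≡ false
        not-x = dec-false (z ≟ℕ x) z≢x
      ... | yes refl = trans (cong (λ b → ind b * ind (does (z ≟ℕ z))) (dec-true (z ∣? n) x∣n)) (*-identityˡ _)

  sum-by-order : (H : ℕ → ℕ) → sumL (allFin n) (λ j → H (ord (toℕ j))) ≡ divisorSum n (λ d → totient d * H d)
  sum-by-order H = begin
      sumL (allFin n) (λ j → H (ord (toℕ j)))
    ≡⟨ sumL-allFin-toℕ n (H ∘ ord) ⟩
      sumL (range n) (H ∘ ord)
    ≡⟨ sumL-range-rotate n (H ∘ ord) (cong H ord0≡ordn) ⟩
      sumL (map suc (range n)) (H ∘ ord)
    ≡⟨ cong (λ l → sumL (map suc l) (H ∘ ord)) (upTo≡range n) ⟨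
      sumL K (H ∘ ord)
    ≡⟨ sumL-cong K (λ k → sym (trans (sumL-delta _≟ℕ_ D (ord k) H)
         (trans (cong (_* H (ord k)) (divisors-once (ord k) (ord-pos k) (ord∣n k))) (*-identityˡ (H (ord k)))))) ⟩
      sumL K (λ k → sumL D (λ d → ind (does (d ≟ℕ ord k)) * H d))
    ≡⟨ sumL-comm K D _ ⟩
      sumL D (λ d → sumL K (λ k → ind (does (d ≟ℕ ord k)) * H d))
    ≡⟨ sumL-cong D (λ d → trans (sumL-*ʳ K (H d) _) (cong (_* H d) (sumL-cong K (λ k → cong ind (does-sym d (ord k)))))) ⟩
      sumL D (λ d → count (λ k → does (ord k ≟ℕ d)) K * H d)
    ≡⟨ sumL-filter (_∣? n) K _ ⟩
      sumL K (λ d → ind (does (d ∣? n)) * (count (λ k → does (ord k ≟ℕ d)) K * H d))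
    ≡⟨ sumL-cong K by-totient ⟩
      sumL K (λ d → ind (does (d ∣? n)) * (totient d * H d))
    ≡⟨ sumL-filter (_∣? n) K _ ⟨
      sumL D (λ d → totient d * H d)
    ≡⟨ sum∘map≡sumL (λ d → totient d * H d) D ⟨
      divisorSum n (λ d → totient d * H d) ∎
    where
    open ≡-Reasoning
    ord0≡ordn : ord 0 ≡ ord n
    ord0≡ordn = trans (cong ord (sym (n%n≡0 n))) (ord-% n)
    does-sym : ∀ x y → does (x ≟ℕ y) ≡ does (y ≟ℕ x)
    does-sym x y = does-⇔ (mk⇔ sym sym) (x ≟ℕ y) (y ≟ℕ x)
    by-totient : ∀ d → ind (does (d ∣? n)) * (count (λ k → does (ord k ≟ℕ d)) K * H d)
                     ≡ ind (does (d ∣? n)) * (totient d * H d)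
    by-totient d with d ∣? n
    ... | no  _              = refl
    ... | yes (divides c eq) = cong (λ t → 1 * (t * H d)) (count-order≡totient d c (trans (*-comm d c) (sym eq)))

module _ (n : ℕ) .{{_ : NonZero n}} where
  open ModArith n
  open FinArith n
  open OrderCount n

  sumL-allFin-permute : (f g : Fin n → Fin n) → (∀ x → g (f x) ≡ x) → (∀ y → f (g y) ≡ y) → (w : Fin n → ℕ) →
                        sumL (allFin n) (w ∘ f) ≡ sumL (allFin n) w
  sumL-allFin-permute f g gf fg w = begin
      sumL (allFin n) (w ∘ f)             ≡⟨ sumL-cong (allFin n) (λ x → sym (+-identityʳ (w (f x)))) ⟩
      sumL (allFin n) (λ x → 1 * w (f x)) ≡⟨ sumL-bijection _≟ᶠ_ _≟ᶠ_ (allFin n) (allFin n) (λ _ → true) (λ _ → true)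
                                              (w ∘ f) w f g (λ x _ → allFin-once n x) (λ y _ → allFin-once n y)
                                              (λ _ _ → refl) (λ _ _ → refl) (λ x _ → gf x) (λ y _ → fg y) (λ _ _ → refl) ⟩
      sumL (allFin n) (λ y → 1 * w y)     ≡⟨ sumL-cong (allFin n) (λ y → +-identityʳ (w y)) ⟩
      sumL (allFin n) w                   ∎
    where open ≡-Reasoning

  sum-translates : (a : Fin n) (H : ℕ → ℕ) →
                   sumL (allFin n) (λ b → H (ord (toℕ a + toℕ b))) ≡ divisorSum n (λ d → totient d * H d)
  sum-translates a H = begin
      sumL (allFin n) (λ b → H (ord (toℕ a + toℕ b)))
    ≡⟨ sumL-cong (allFin n) (λ b → cong H (trans (sym (ord-% (toℕ a + toℕ b))) (cong ord (sym (toℕ-+ₙ a b))))) ⟩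
      sumL (allFin n) (λ b → H (ord (toℕ (a +ₙ b))))
    ≡⟨ sumL-allFin-permute (a +ₙ_) (_-ₙ a) ([a+b]-a≡b a) (a+[j-a]≡j a) (λ j → H (ord (toℕ j))) ⟩
      sumL (allFin n) (λ j → H (ord (toℕ j)))
    ≡⟨ sum-by-order H ⟩
      divisorSum n (λ d → totient d * H d) ∎
    where open ≡-Reasoning

  sum-translates-neg : (a : Fin n) (H : ℕ → ℕ) →
                       sumL (allFin n) (λ b → H (ord (toℕ a + toℕ (neg b)))) ≡ divisorSum n (λ d → totient d * H d)
  sum-translates-neg a H =
    trans (sumL-allFin-permute neg neg neg-involutive neg-involutive (λ b → H (ord (toℕ a + toℕ b)))) (sum-translates a H)

module _ {R : Subgroup} (Ts : TileSet R) where
  open TileSet Ts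

  tfix≡count : ∀ g (p : g ∈ R) → tfix Ts g p ≡ count (λ t → does (act t g p ≟ᶠ t)) (allFin size)
  tfix≡count g p = length∘filter≡count (λ t → act t g p ≟ᶠ t) (allFin size)

  tfix-id : tfix Ts idD8 (Subgroup.id∈ R) ≡ size
  tfix-id = trans (tfix≡count idD8 (Subgroup.id∈ R))
    (count-allFin-true size _ (λ t → dec-true (_ ≟ᶠ t) (act-id t (Subgroup.id∈ R))))

  reflection-involutive : ∀ k (p : σ k ∈ R) t → act (act t (σ k) p) (σ k) p ≡ t
  reflection-involutive k p t = trans (act-∙ t (σ k) (σ k) p p (subst (_∈ R) (sym (σσ≡id k)) (Subgroup.id∈ R)))
    (act-id-∈ (σ k ∙ σ k) (σσ≡id k))
    where
    σσ≡id : ∀ k → σ k ∙ σ k ≡ idD8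
    σσ≡id zero                   = refl
    σσ≡id (suc zero)             = refl
    σσ≡id (suc (suc zero))       = refl
    σσ≡id (suc (suc (suc zero))) = refl
    act-id-∈ : ∀ g → (e : g ≡ idD8) → act t g (subst (_∈ R) (sym e) (Subgroup.id∈ R)) ≡ t
    act-id-∈ _ refl = act-id t (Subgroup.id∈ R)

  numFixed≡count : ∀ {n} .{{_ : NonZero n}} (ab : Cell n) g (p : g ∈ R) →
    numFixed Ts ab g p ≡ count (equivariantᵇ (λ c → affAct c ab g) (λ t → act t g p)) (allTilings n size)
  numFixed≡count {n} ab g p = trans (length∘filter≡count (λ τ → isFixed? Ts τ ab g p) (allTilings n size))
    (sumL-cong (allTilings n size) (λ τ → cong ind (does≡ (isFixed? Ts τ ab g p) _
      (equivariantᵇ-complete _ _ τ) (equivariantᵇ-sound _ _ τ))))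

module _ (n : ℕ) .{{_ : NonZero n}} {R : Subgroup} (Ts : TileSet R) where
  open TileSet Ts
  open ModArith n
  open FinArith n

  FixSq-by-translates : ∀ g (p : g ∈ R) (shift : Fin n → Fin n → ℕ) →
    (∀ a b → numFixed Ts (a , b) g p ≡ fixFormula n size (tfix Ts g p) (ord (shift a b))) →
    (∀ a (H : ℕ → ℕ) → sumL (allFin n) (λ b → H (ord (shift a b))) ≡ divisorSum n (λ d → totient d * H d)) →
    FixSq n Ts g p ≡ n * divisorSum n (λ d → totient d * fixFormula n size (tfix Ts g p) d)
  FixSq-by-translates g p shift per-translate sum-over = begin
      FixSq n Ts g p
    ≡⟨ sum∘map≡sumL _ (allFin n) ⟩
      sumL (allFin n) (λ a → sum (map (λ b → numFixed Ts (a , b) g p) (allFin n)))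
    ≡⟨ sumL-cong (allFin n) (λ a → trans (sum∘map≡sumL _ (allFin n))
         (trans (sumL-cong (allFin n) (per-translate a)) (sum-over a (fixFormula n size (tfix Ts g p))))) ⟩
      sumL (allFin n) (λ _ → divisorSum n (λ d → totient d * fixFormula n size (tfix Ts g p) d))
    ≡⟨ trans (sumL-allFin n _) (sumF-const n _) ⟩
      n * divisorSum n (λ d → totient d * fixFormula n size (tfix Ts g p) d) ∎
    where open ≡-Reasoning

  FixSq-rf : (p : rf ∈ R) → FixSq n Ts rf p ≡ n * divisorSum n (λ d → totient d * fixFormula n size (tfix Ts rf p) d)
  FixSq-rf p = FixSq-by-translates rf p (λ a b → toℕ a + toℕ b)
    (λ a b → trans (numFixed≡count Ts (a , b) rf p)
      (trans (count-rf-equivariant n a b size _ (reflection-involutive Ts (suc zero) p))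
        (cong (λ t → fixFormula n size t (ord (toℕ a + toℕ b))) (sym (tfix≡count Ts rf p)))))
    (λ a H → sum-translates n a H)

  FixSq-r3f : (p : r3f ∈ R) → FixSq n Ts r3f p ≡ n * divisorSum n (λ d → totient d * fixFormula n size (tfix Ts r3f p) d)
  FixSq-r3f p = FixSq-by-translates r3f p (λ a b → toℕ a + toℕ (neg b))
    (λ a b → trans (numFixed≡count Ts (a , b) r3f p)
      (trans (count-r3f-equivariant n a b size _ (reflection-involutive Ts (suc (suc (suc zero))) p))
        (cong (λ t → fixFormula n size t (ord (toℕ a + toℕ (neg b)))) (sym (tfix≡count Ts r3f p)))))
    (λ a H → sum-translates-neg n a H)

  totient*fixFormula : ∀ t d → totient d * fixFormula n size t d ≡
    (if isOdd d
     then totient d * tfix Ts idD8 (Subgroup.id∈ R) ^ ((n * n ∸ n) div (2 * d)) * t ^ (n div d)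
     else totient d * tfix Ts idD8 (Subgroup.id∈ R) ^ ((n * n) div (2 * d)))
  totient*fixFormula t d = trans (cong (λ M → totient d * fixFormula n M t d) (sym (tfix-id Ts))) (distribute (isOdd d))
    where
    M : ℕ
    M = tfix Ts idD8 (Subgroup.id∈ R)
    distribute : ∀ s →
      totient d * (if s then M ^ ((n * n ∸ n) div (2 * d)) * t ^ (n div d) else M ^ ((n * n) div (2 * d)))
      ≡ (if s then totient d * M ^ ((n * n ∸ n) div (2 * d)) * t ^ (n div d) else totient d * M ^ ((n * n) div (2 * d)))
    distribute true  = sym (*-assoc (totient d) _ _)
    distribute false = refl

divisorSum-cong : ∀ n {F G : ℕ → ℕ} → (∀ d → F d ≡ G d) → divisorSum n F ≡ divisorSum n G
divisorSum-cong n F≗G = cong sum (Listₚ.map-cong F≗G (filter (_∣? n) (map suc (upTo n))))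

mainTheorem16 : (n : ℕ) .{{_ : NonZero n}} (R : Subgroup) (Ts : TileSet R) →
  ((p : rf ∈ R) →
    FixSq n Ts rf p
      ≡ n * divisorSum n (λ d →
              if isOdd d
              then totient d * tfix Ts idD8 (Subgroup.id∈ R) ^ ((n * n ∸ n) div (2 * d))
                     * tfix Ts rf p ^ (n div d)
              else totient d * tfix Ts idD8 (Subgroup.id∈ R) ^ ((n * n) div (2 * d))))
  ×
  ((p : r3f ∈ R) →
    FixSq n Ts r3f p
      ≡ n * divisorSum n (λ d →
              if isOdd d
              then totient d * tfix Ts idD8 (Subgroup.id∈ R) ^ ((n * n ∸ n) div (2 * d))
                     * tfix Ts r3f p ^ (n div d)
              else totient d * tfix Ts idD8 (Subgroup.id∈ R) ^ ((n * n) div (2 * d))))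
mainTheorem16 n R Ts =
  (λ p → trans (FixSq-rf n Ts p) (cong (n *_) (divisorSum-cong n (λ d → totient*fixFormula n Ts (tfix Ts rf p) d)))) ,
  (λ p → trans (FixSq-r3f n Ts p) (cong (n *_) (divisorSum-cong n (λ d → totient*fixFormula n Ts (tfix Ts r3f p) d))))
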